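{- Let $k\ge 3$. If $\mathcal{G}$ is a (non-degenerate) $[n,k,d]_q$ A$^s$MDS code with $n=(s+1)(q+1)+k-3$, then for each $0\le j\le k-3$ the numbers \[ \alpha_j=\frac{\binom{n-j}{k-2-j}}{\binom{k+s-2-j}{k-2-j}}\quad\text{and}\quad \beta_j=\alpha_j\cdot\frac{q(s+1)}{k+s-1-j} \] are integers.
   Context: A linear $[n,k,d]_q$ code is identified with a projective system: a finite multiset $\mathcal{G}$ of $n$ points (counted with multiplicity) of $\mathrm{PG}(k-1,q)$, not all lying in one hyperplane, with $n-d=\max_H|\mathcal{G}\cap H|$ over hyperplanes $H$ (counted with multiplicity). The Singleton defect is $n-k+1-d$; the code is A$^s$MDS if its defect is $s$. -}

module Defs where

open import Level using (0ℓ)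
open import Data.Nat as ℕ using (ℕ; zero; suc)
open import Data.Fin using (Fin; zero; suc)
open import Data.List using (List; length; filter)
open import Data.List.Relation.Unary.All using (All)
open import Data.List.Relation.Unary.Unique.Propositional using (Unique)
open import Data.List.Membership.Propositional using (_∈_)
open import Data.Product using (∃; _×_; _,_)
open import Relation.Binary.PropositionalEquality using (_≡_; _≢_)
open import Relation.Binary.Definitions using (DecidableEquality)
open import Relation.Nullary using (¬_)
open import Algebra.Structures using (IsCommutativeRing)

record FiniteField : Set₁ where
  field
    Carrier : Set
    _+_ _*_ : Carrier → Carrier → Carrier
    -_      : Carrier → Carrier
    0# 1#   : Carrier
    isCommutativeRing : IsCommutativeRing _≡_ _+_ _*_ -_ 0# 1#
    0≢1     : 0# ≢ 1#
    inverse : ∀ x → x ≢ 0# → ∃ λ y → x * y ≡ 1#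
    _≟_     : DecidableEquality Carrier
    elements          : List Carrier
    elements-unique   : Unique elements
    elements-complete : ∀ x → x ∈ elements

  order : ℕ
  order = length elements

module _ (F : FiniteField) where
  open FiniteField F

  Vecᶠ : ℕ → Set
  Vecᶠ k = Fin k → Carrier

  sumᶠ : ∀ {k} → Vecᶠ k → Carrier
  sumᶠ {zero}  v = 0#
  sumᶠ {suc k} v = v zero + sumᶠ (λ i → v (suc i))

  dot : ∀ {k} → Vecᶠ k → Vecᶠ k → Carrier
  dot a v = sumᶠ (λ i → a i * v i)

  NonZero : ∀ {k} → Vecᶠ k → Set
  NonZero v = ¬ (∀ i → v i ≡ 0#)

  -- number of points of the multiset G (list of representatives of points
  -- of PG(k-1,q)) lying on the hyperplane with coordinates a, with multiplicity
  hyperplaneCount : ∀ {k} → Vecᶠ k → List (Vecᶠ k) → ℕ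
  hyperplaneCount a G = length (filter (λ v → dot a v ≟ 0#) G)

  NonDegenerate : ∀ {k} → List (Vecᶠ k) → Set
  NonDegenerate {k} G = ∀ (a : Vecᶠ k) → NonZero a → ¬ All (λ v → dot a v ≡ 0#) G

  IsMaxHyperplaneCount : ∀ {k} → List (Vecᶠ k) → ℕ → Set
  IsMaxHyperplaneCount {k} G m =
    (∀ (a : Vecᶠ k) → NonZero a → hyperplaneCount a G ℕ.≤ m)
    × (∃ λ (a : Vecᶠ k) → NonZero a × hyperplaneCount a G ≡ m)

  IsProjCode : (n k d : ℕ) → List (Vecᶠ k) → Set
  IsProjCode n k d G =
    length G ≡ n × All NonZero G × NonDegenerate G
    × (∃ λ m → IsMaxHyperplaneCount G m × n ≡ m ℕ.+ d)

  -- an [n,k,d]_q code is A^s MDS: Singleton defect n - k + 1 - d equals s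
  IsAsMDS : (s n k d : ℕ) → List (Vecᶠ k) → Set
  IsAsMDS s n k d G = IsProjCode n k d G × n ℕ.+ 1 ≡ k ℕ.+ d ℕ.+ s

{-# OPTIONS --safe #-}
-- A nonzero a ∈ F^k is the normal of a hyperplane, which carries pointsOn a ≤ m = k - 1 + s points
-- of G. For points S of G, count the incidences between G and the hyperplanes through ⟨S⟩ in two
-- ways: a point outside ⟨S⟩ lies on a 1/q fraction of them. Comparing with the bound m, the length
-- n = (s + 1)(q + 1) + k - 3 forces any k - 2 points of G to span a codimension-2 space containing
-- no further point of G, with one of the q + 1 hyperplanes through it carrying m - 1 points and
-- the other q carrying m. Fix j points J of G and double count the pairs (H, K) of a hyperplane
-- H ⊇ J with M points and a (k - 2 - j)-set K of the remaining points on H: with r = k - 2 - j,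
-- N_M(J) C(M - j, r) = C(n - j, r) c_M, where c_{m-1} = 1 and c_m = q. So α_j = N_{m-1}(J), and
-- q C(n - j, r) / C(m - j, r) = N_m(J) is an integer, which equals β_j by
-- C(m - j, r)(s + 1) = C(m - 1 - j, r)(m - j).
module Submission where

open import Algebra.Bundles using (CommutativeSemigroup)
open import Algebra.Structures using (IsCommutativeRing)
open import Data.Empty using (⊥-elim)
open import Data.Fin using (zero; suc)
open import Data.List using (List; []; _∷_; length; _++_; map; filter; take; drop; cartesianProductWith)
open import Data.List.Membership.Propositional using (_∈_; find)
open import Data.List.Membership.Propositional.Properties using (∈-cartesianProductWith⁺)
open import Data.List.Properties using (length-take; length-drop; take++drop≡id; length-++)
open import Data.List.Relation.Binary.Sublist.Propositional using (_⊆_; []; _∷_; _∷ʳ_; ⊆-refl)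
open import Data.List.Relation.Binary.Sublist.Propositional.Properties using (++⁺; []⊆-universal)
open import Data.List.Relation.Unary.All as All using (All; []; _∷_)
open import Data.List.Relation.Unary.All.Properties as Allₚ using (¬All⇒Any¬)
open import Data.List.Relation.Unary.AllPairs using ([]; _∷_)
open import Data.List.Relation.Unary.Any using (here; there; satisfied)
open import Data.List.Relation.Unary.Unique.Propositional using (Unique)
open import Data.Nat as ℕ using (ℕ; zero; suc; _+_; _*_; _∸_; _^_; _≤_; _<_; z≤n; s≤s; >-nonZero; ≢-nonZero)
open import Data.Nat.Combinatorics using (_C_; nCk+nC[k+1]≡[n+1]C[k+1]; nC1≡n)
open import Data.Nat.Divisibility using (_∣_; divides; ∣⇒≤; ∣m∣n⇒∣m+n; n∣m*n; *-cancelʳ-∣; *-monoʳ-∣; *-monoˡ-∣)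
open import Data.Nat.Properties hiding (_≟_)
open import Data.Nat.Properties using () renaming (_≟_ to _≟ℕ_)
open import Data.Nat.Tactic.RingSolver using (solve-∀)
open import Data.Product using (_×_; _,_; proj₁; proj₂; ∃)
open import Data.Sum using (_⊎_; inj₁; inj₂)
open import Data.Vec using (Vec; []; _∷_; lookup; zipWith; replicate)
import Data.Vec as Vec
open import Data.Vec.Properties using (∷-injective; ≡-dec)
open import Function using (_∘_)
open import Relation.Nullary using (Dec; yes; no; ¬_)
open import Relation.Nullary.Decidable using (_×-dec_; _→-dec_; ¬?)
open import Relation.Unary using (Decidable)
open import Relation.Binary.PropositionalEquality
open import Algebra.Properties.CommutativeSemigroup +-commutativeSemigroup using (interchange)
open import Defs

-- Sums, indicators and combinations over lists

module _ {A : Set} where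

  ∑ : List A → (A → ℕ) → ℕ
  ∑ []       f = 0
  ∑ (x ∷ xs) f = f x + ∑ xs f

  ∑-cong : ∀ xs {f g : A → ℕ} → (∀ x → f x ≡ g x) → ∑ xs f ≡ ∑ xs g
  ∑-cong []       f≡g = refl
  ∑-cong (x ∷ xs) f≡g = cong₂ _+_ (f≡g x) (∑-cong xs f≡g)

  ∑-+ : ∀ xs (f g : A → ℕ) → ∑ xs (λ x → f x + g x) ≡ ∑ xs f + ∑ xs g
  ∑-+ []       f g = refl
  ∑-+ (x ∷ xs) f g = trans (cong (f x + g x +_) (∑-+ xs f g)) (interchange (f x) (g x) (∑ xs f) (∑ xs g))

  ∑-*ˡ : ∀ xs c (f : A → ℕ) → ∑ xs (λ x → c * f x) ≡ c * ∑ xs f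
  ∑-*ˡ []       c f = sym (*-zeroʳ c)
  ∑-*ˡ (x ∷ xs) c f = trans (cong (c * f x +_) (∑-*ˡ xs c f)) (sym (*-distribˡ-+ c (f x) (∑ xs f)))

  ∑-*ʳ : ∀ xs c (f : A → ℕ) → ∑ xs (λ x → f x * c) ≡ ∑ xs f * c
  ∑-*ʳ xs c f = trans (∑-cong xs (λ x → *-comm (f x) c)) (trans (∑-*ˡ xs c f) (*-comm c (∑ xs f)))

  ∑-const : ∀ xs c → ∑ xs (λ _ → c) ≡ length xs * c
  ∑-const []       c = refl
  ∑-const (x ∷ xs) c = cong (c +_) (∑-const xs c)

  ∑-++ : ∀ xs ys (f : A → ℕ) → ∑ (xs ++ ys) f ≡ ∑ xs f + ∑ ys f
  ∑-++ []       ys f = refl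
  ∑-++ (x ∷ xs) ys f = trans (cong (f x +_) (∑-++ xs ys f)) (sym (+-assoc (f x) (∑ xs f) (∑ ys f)))

  ∑-mono : ∀ xs {f g : A → ℕ} → (∀ x → f x ≤ g x) → ∑ xs f ≤ ∑ xs g
  ∑-mono []       f≤g = z≤n
  ∑-mono (x ∷ xs) f≤g = +-mono-≤ (f≤g x) (∑-mono xs f≤g)

  ∑-mono-< : ∀ xs {f g : A → ℕ} → (∀ x → f x ≤ g x) → ∀ {x} → x ∈ xs → f x < g x → ∑ xs f < ∑ xs g
  ∑-mono-< (y ∷ xs) f≤g (here refl) fx<gx = +-mono-<-≤ fx<gx (∑-mono xs f≤g)
  ∑-mono-< (y ∷ xs) f≤g (there x∈xs) fx<gx = +-mono-≤-< (f≤g y) (∑-mono-< xs f≤g x∈xs fx<gx)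

  ∑-mono-⊆ : ∀ {xs ys} (f : A → ℕ) → xs ⊆ ys → ∑ xs f ≤ ∑ ys f
  ∑-mono-⊆ f []             = z≤n
  ∑-mono-⊆ f (y ∷ʳ xs⊆ys)   = ≤-trans (∑-mono-⊆ f xs⊆ys) (m≤n+m _ (f y))
  ∑-mono-⊆ f (refl ∷ xs⊆ys) = +-monoʳ-≤ _ (∑-mono-⊆ f xs⊆ys)

  ∑-≤-≡⇒≡ : ∀ xs {f g : A → ℕ} → (∀ x → f x ≤ g x) → ∑ xs f ≡ ∑ xs g → ∀ {x} → x ∈ xs → f x ≡ g x
  ∑-≤-≡⇒≡ xs {f} {g} f≤g ∑f≡∑g {x} x∈xs with m≤n⇒m<n∨m≡n (f≤g x)
  ... | inj₁ fx<gx = ⊥-elim (<-irrefl ∑f≡∑g (∑-mono-< xs f≤g x∈xs fx<gx))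
  ... | inj₂ fx≡gx = fx≡gx

module _ {A B : Set} where

  ∑-map : (h : A → B) (xs : List A) (f : B → ℕ) → ∑ (map h xs) f ≡ ∑ xs (λ x → f (h x))
  ∑-map h []       f = refl
  ∑-map h (x ∷ xs) f = cong (f (h x) +_) (∑-map h xs f)

  ∑-comm : (xs : List A) (ys : List B) (f : A → B → ℕ) →
           ∑ xs (λ x → ∑ ys (f x)) ≡ ∑ ys (λ y → ∑ xs (λ x → f x y))
  ∑-comm []       ys f = sym (trans (∑-const ys 0) (*-zeroʳ (length ys)))
  ∑-comm (x ∷ xs) ys f = trans (cong (∑ ys (f x) +_) (∑-comm xs ys f)) (sym (∑-+ ys (f x) _))

module _ {A B C : Set} where

  ∑-cartesianProductWith : (g : A → B → C) (xs : List A) (ys : List B) (f : C → ℕ) →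
    ∑ (cartesianProductWith g xs ys) f ≡ ∑ xs (λ x → ∑ ys (λ y → f (g x y)))
  ∑-cartesianProductWith g []       ys f = refl
  ∑-cartesianProductWith g (x ∷ xs) ys f =
    trans (∑-++ (map (g x) ys) _ f) (cong₂ _+_ (∑-map (g x) ys f) (∑-cartesianProductWith g xs ys f))

𝟙 : {P : Set} → Dec P → ℕ
𝟙 (yes _) = 1
𝟙 (no _)  = 0

module _ {P Q : Set} where

  𝟙-cong : (P → Q) → (Q → P) → (p? : Dec P) (q? : Dec Q) → 𝟙 p? ≡ 𝟙 q?
  𝟙-cong to from (yes p) (yes q) = refl
  𝟙-cong to from (yes p) (no ¬q) = ⊥-elim (¬q (to p))
  𝟙-cong to from (no ¬p) (yes q) = ⊥-elim (¬p (from q))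
  𝟙-cong to from (no ¬p) (no ¬q) = refl

  𝟙-× : (p? : Dec P) (q? : Dec Q) → 𝟙 (p? ×-dec q?) ≡ 𝟙 p? * 𝟙 q?
  𝟙-× (yes _) (yes _) = refl
  𝟙-× (yes _) (no _)  = refl
  𝟙-× (no _)  _       = refl

  𝟙-mono : (P → Q) → (p? : Dec P) (q? : Dec Q) → 𝟙 p? ≤ 𝟙 q?
  𝟙-mono to (yes p) (yes q) = ≤-refl
  𝟙-mono to (yes p) (no ¬q) = ⊥-elim (¬q (to p))
  𝟙-mono to (no ¬p) q?      = z≤n

𝟙-yes : {P : Set} (p? : Dec P) → P → 𝟙 p? ≡ 1
𝟙-yes (yes _) _ = refl
𝟙-yes (no ¬p) p = ⊥-elim (¬p p)

𝟙-no : {P : Set} (p? : Dec P) → ¬ P → 𝟙 p? ≡ 0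
𝟙-no (yes p) ¬p = ⊥-elim (¬p p)
𝟙-no (no _)  _  = refl

module _ {A : Set} {P : A → Set} (P? : Decidable P) where

  count : List A → ℕ
  count xs = ∑ xs (λ x → 𝟙 (P? x))

  length-filter : ∀ xs → length (filter P? xs) ≡ count xs
  length-filter []       = refl
  length-filter (x ∷ xs) with P? x
  ... | yes _ = cong suc (length-filter xs)
  ... | no _  = length-filter xs

  count-All : ∀ {xs} → All P xs → count xs ≡ length xs
  count-All {[]}     []         = refl
  count-All {x ∷ xs} (px ∷ pxs) = cong₂ _+_ (𝟙-yes (P? x) px) (count-All pxs)

module _ {A : Set} where

  combinations : ℕ → List A → List (List A)
  combinations zero    xs       = [] ∷ []
  combinations (suc r) []       = []
  combinations (suc r) (x ∷ xs) = map (x ∷_) (combinations r xs) ++ combinations (suc r) xs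

  private
    ∑-combinations-∷ : ∀ r x xs (g : List A → ℕ) →
      ∑ (combinations (suc r) (x ∷ xs)) g ≡ ∑ (combinations r xs) (λ K → g (x ∷ K)) + ∑ (combinations (suc r) xs) g
    ∑-combinations-∷ r x xs g =
      trans (∑-++ (map (x ∷_) (combinations r xs)) _ g) (cong (_+ _) (∑-map (x ∷_) (combinations r xs) g))

  count-combinations-All : {Q : A → Set} (Q? : Decidable Q) (r : ℕ) (xs : List A) →
    count (All.all? Q?) (combinations r xs) ≡ count Q? xs C r
  count-combinations-All Q? zero    xs       = refl
  count-combinations-All Q? (suc r) []       = refl
  count-combinations-All {Q} Q? (suc r) (x ∷ xs) = begin
    count (All.all? Q?) (combinations (suc r) (x ∷ xs))
      ≡⟨ ∑-combinations-∷ r x xs _ ⟩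
    ∑ (combinations r xs) (λ K → 𝟙 (All.all? Q? (x ∷ K))) + count (All.all? Q?) (combinations (suc r) xs)
      ≡⟨ cong₂ _+_ (∑-cong (combinations r xs) (λ K → 𝟙-all?-∷ (All.all? Q? K))) (count-combinations-All Q? (suc r) xs) ⟩
    ∑ (combinations r xs) (λ K → 𝟙 (Q? x) * 𝟙 (All.all? Q? K)) + c C suc r
      ≡⟨ cong (_+ c C suc r) (trans (∑-*ˡ (combinations r xs) (𝟙 (Q? x)) _) (cong (𝟙 (Q? x) *_) (count-combinations-All Q? r xs))) ⟩
    𝟙 (Q? x) * (c C r) + c C suc r
      ≡⟨ pascal (Q? x) ⟩
    (𝟙 (Q? x) + c) C suc r ∎
    where
    open ≡-Reasoning
    c : ℕ
    c = count Q? xs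
    𝟙-all?-∷ : ∀ {K} (all? : Dec (All Q K)) → 𝟙 (All.all? Q? (x ∷ K)) ≡ 𝟙 (Q? x) * 𝟙 all?
    𝟙-all?-∷ all? = trans (𝟙-cong All.uncons (λ (qx , qK) → qx ∷ qK) _ (Q? x ×-dec all?)) (𝟙-× (Q? x) all?)
    pascal : (qx? : Dec (Q x)) → 𝟙 qx? * (c C r) + c C suc r ≡ (𝟙 qx? + c) C suc r
    pascal (yes _) = trans (cong (_+ c C suc r) (+-identityʳ (c C r))) (nCk+nC[k+1]≡[n+1]C[k+1] c r)
    pascal (no _)  = refl

  ∑-combinations-const : (g : List A → ℕ) (c r : ℕ) (xs : List A) →
    (∀ K → K ⊆ xs → length K ≡ r → g K ≡ c) → ∑ (combinations r xs) g ≡ (length xs C r) * c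
  ∑-combinations-const g c zero    xs       g≡c = trans (+-identityʳ (g [])) (trans (g≡c [] ([]⊆-universal xs) refl) (sym (+-identityʳ c)))
  ∑-combinations-const g c (suc r) []       g≡c = refl
  ∑-combinations-const g c (suc r) (x ∷ xs) g≡c = begin
    ∑ (combinations (suc r) (x ∷ xs)) g
      ≡⟨ ∑-combinations-∷ r x xs g ⟩
    ∑ (combinations r xs) (λ K → g (x ∷ K)) + ∑ (combinations (suc r) xs) g
      ≡⟨ cong₂ _+_ (∑-combinations-const (λ K → g (x ∷ K)) c r xs (λ K K⊆xs |K|≡r → g≡c (x ∷ K) (refl ∷ K⊆xs) (cong suc |K|≡r)))
                   (∑-combinations-const g c (suc r) xs (λ K K⊆xs |K|≡r → g≡c K (x ∷ʳ K⊆xs) |K|≡r)) ⟩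
    (length xs C r) * c + (length xs C suc r) * c
      ≡⟨ sym (*-distribʳ-+ c (length xs C r) (length xs C suc r)) ⟩
    ((length xs C r) + (length xs C suc r)) * c
      ≡⟨ cong (_* c) (nCk+nC[k+1]≡[n+1]C[k+1] (length xs) r) ⟩
    (suc (length xs) C suc r) * c ∎
    where open ≡-Reasoning

-- Arithmetic of natural numbers and binomial coefficients

[1+m+n]∸m≡1+n : ∀ m n → suc (m + n) ∸ m ≡ suc n
[1+m+n]∸m≡1+n m n = trans (cong (_∸ m) (sym (+-suc m n))) (m+n∸m≡n m (suc n))

n≤m∧m∸n≡1⇒n≡m∸1 : ∀ {m n} → n ≤ m → m ∸ n ≡ 1 → n ≡ m ∸ 1
n≤m∧m∸n≡1⇒n≡m∸1 {m} {n} n≤m m∸n≡1 = sym (begin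
  m ∸ 1             ≡⟨ cong (_∸ 1) (sym (m+[n∸m]≡n n≤m)) ⟩
  n + (m ∸ n) ∸ 1   ≡⟨ cong (λ x → n + x ∸ 1) m∸n≡1 ⟩
  n + 1 ∸ 1         ≡⟨ m+n∸n≡m n 1 ⟩
  n                 ∎)
  where open ≡-Reasoning

singleton-defect⇒m≡2+κ+s : ∀ κ {n m d s} → n ≡ m + d → n + 1 ≡ 3 + κ + d + s → m ≡ 2 + κ + s
singleton-defect⇒m≡2+κ+s κ {n} {m} {d} {s} n≡m+d n+1≡3+κ+d+s = +-cancelʳ-≡ (d + 1) m _ (begin
  m + (d + 1)           ≡⟨ sym (+-assoc m d 1) ⟩
  m + d + 1             ≡⟨ cong (_+ 1) (sym n≡m+d) ⟩
  n + 1                 ≡⟨ n+1≡3+κ+d+s ⟩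
  3 + κ + d + s         ≡⟨ regroup κ d s ⟩
  2 + κ + s + (d + 1)   ∎)
  where
  open ≡-Reasoning
  regroup : ∀ κ d s → 3 + κ + d + s ≡ 2 + κ + s + (d + 1)
  regroup = solve-∀

d∣m∧m*c≡n*d⇒c∣n : ∀ {d m n c} .{{_ : ℕ.NonZero d}} → d ∣ m → m * c ≡ n * d → c ∣ n
d∣m∧m*c≡n*d⇒c∣n {d} {m} {n} {c} d∣m m*c≡n*d =
  *-cancelʳ-∣ d (subst (c * d ∣_) (trans (*-comm c m) m*c≡n*d) (*-monoʳ-∣ c d∣m))

[k+1]*[n+1]C[k+1]≡[n+1]*nCk : ∀ n k → suc k * (suc n C suc k) ≡ suc n * (n C k)
[k+1]*[n+1]C[k+1]≡[n+1]*nCk zero    zero    = refl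
[k+1]*[n+1]C[k+1]≡[n+1]*nCk zero    (suc k) = *-zeroʳ (suc (suc k))
[k+1]*[n+1]C[k+1]≡[n+1]*nCk (suc n) zero    = trans (+-identityʳ _) (trans (nC1≡n (suc (suc n))) (sym (*-identityʳ (suc (suc n)))))
[k+1]*[n+1]C[k+1]≡[n+1]*nCk (suc n) (suc k) = begin
  suc (suc k) * (suc (suc n) C suc (suc k))
    ≡⟨ cong (suc (suc k) *_) (sym (nCk+nC[k+1]≡[n+1]C[k+1] (suc n) (suc k))) ⟩
  suc (suc k) * ((suc n C suc k) + (suc n C suc (suc k)))
    ≡⟨ split k (suc n C suc k) (suc n C suc (suc k)) ⟩
  suc k * (suc n C suc k) + (suc n C suc k) + suc (suc k) * (suc n C suc (suc k))
    ≡⟨ cong₂ (λ x y → x + (suc n C suc k) + y) ([k+1]*[n+1]C[k+1]≡[n+1]*nCk n k) ([k+1]*[n+1]C[k+1]≡[n+1]*nCk n (suc k)) ⟩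
  suc n * (n C k) + (suc n C suc k) + suc n * (n C suc k)
    ≡⟨ merge n (n C k) (suc n C suc k) (n C suc k) ⟩
  suc n * ((n C k) + (n C suc k)) + (suc n C suc k)
    ≡⟨ cong (λ x → suc n * x + (suc n C suc k)) (nCk+nC[k+1]≡[n+1]C[k+1] n k) ⟩
  suc n * (suc n C suc k) + (suc n C suc k)
    ≡⟨ +-comm (suc n * (suc n C suc k)) _ ⟩
  suc (suc n) * (suc n C suc k) ∎
  where
  open ≡-Reasoning
  split : ∀ k a b → suc (suc k) * (a + b) ≡ suc k * a + a + suc (suc k) * b
  split = solve-∀
  merge : ∀ n a b c → suc n * a + b + suc n * c ≡ suc n * (a + c) + b
  merge = solve-∀

[k+t]Ck*t≡[k+1]*[k+t]C[k+1] : ∀ k t → ((k + t) C k) * t ≡ suc k * ((k + t) C suc k)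
[k+t]Ck*t≡[k+1]*[k+t]C[k+1] k t = +-cancelˡ-≡ (suc k * c) _ _ (begin
  suc k * c + c * t                          ≡⟨ collect k t c ⟩
  suc (k + t) * c                            ≡⟨ sym ([k+1]*[n+1]C[k+1]≡[n+1]*nCk (k + t) k) ⟩
  suc k * (suc (k + t) C suc k)              ≡⟨ cong (suc k *_) (sym (nCk+nC[k+1]≡[n+1]C[k+1] (k + t) k)) ⟩
  suc k * (c + ((k + t) C suc k))            ≡⟨ *-distribˡ-+ (suc k) c _ ⟩
  suc k * c + suc k * ((k + t) C suc k)      ∎)
  where
  open ≡-Reasoning
  c : ℕ
  c = (k + t) C k
  collect : ∀ k t c → suc k * c + c * t ≡ suc (k + t) * c
  collect = solve-∀

[k+s]Ck*[k+s+1]≡[k+s+1]Ck*[s+1] : ∀ k s → ((k + s) C k) * suc (k + s) ≡ (suc (k + s) C k) * suc s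
[k+s]Ck*[k+s+1]≡[k+s+1]Ck*[s+1] k s = begin
  ((k + s) C k) * suc (k + s)     ≡⟨ *-comm ((k + s) C k) _ ⟩
  suc (k + s) * ((k + s) C k)     ≡⟨ sym ([k+1]*[n+1]C[k+1]≡[n+1]*nCk (k + s) k) ⟩
  suc k * (suc (k + s) C suc k)   ≡⟨ cong (λ n → suc k * (n C suc k)) (sym (+-suc k s)) ⟩
  suc k * ((k + suc s) C suc k)   ≡⟨ sym ([k+t]Ck*t≡[k+1]*[k+t]C[k+1] k (suc s)) ⟩
  ((k + suc s) C k) * suc s       ≡⟨ cong (λ n → (n C k) * suc s) (+-suc k s) ⟩
  (suc (k + s) C k) * suc s       ∎
  where open ≡-Reasoning

-- Finite fields and their dual vectors

module FiniteFieldSums (F : FiniteField) where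

  open FiniteField F renaming (_+_ to _⊞_; _*_ to _⊠_; -_ to ⊟_)
  private module R = IsCommutativeRing isCommutativeRing

  ⊞-commutativeSemigroup : CommutativeSemigroup _ _
  ⊞-commutativeSemigroup = record { isCommutativeSemigroup = R.+-isCommutativeSemigroup }

  open import Algebra.Properties.CommutativeSemigroup ⊞-commutativeSemigroup using () renaming (interchange to ⊞-interchange)

  inv : (c : Carrier) → c ≢ 0# → Carrier
  inv c c≢0 = proj₁ (inverse c c≢0)

  module _ (c : Carrier) (c≢0 : c ≢ 0#) where

    ⊠-inverseʳ : c ⊠ inv c c≢0 ≡ 1#
    ⊠-inverseʳ = proj₂ (inverse c c≢0)

    ⊠-inverseˡ : inv c c≢0 ⊠ c ≡ 1#
    ⊠-inverseˡ = trans (R.*-comm _ c) ⊠-inverseʳ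

    inv-cancelˡ : ∀ x → inv c c≢0 ⊠ (c ⊠ x) ≡ x
    inv-cancelˡ x = trans (sym (R.*-assoc _ c x)) (trans (cong (_⊠ x) ⊠-inverseˡ) (R.*-identityˡ x))

    inv-cancelʳ : ∀ x → c ⊠ (inv c c≢0 ⊠ x) ≡ x
    inv-cancelʳ x = trans (sym (R.*-assoc c _ x)) (trans (cong (_⊠ x) ⊠-inverseʳ) (R.*-identityˡ x))

    ⊠-cancel-≡0 : ∀ x → c ⊠ x ≡ 0# → x ≡ 0#
    ⊠-cancel-≡0 x cx≡0 = trans (sym (inv-cancelˡ x)) (trans (cong (inv c c≢0 ⊠_) cx≡0) (R.zeroʳ _))

  ⊞-⊟-cancelʳ : ∀ x y → (x ⊞ y) ⊞ (⊟ y) ≡ x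
  ⊞-⊟-cancelʳ x y = trans (R.+-assoc x y (⊟ y)) (trans (cong (x ⊞_) (R.-‿inverseʳ y)) (R.+-identityʳ x))

  ⊟-⊞-cancelʳ : ∀ x y → (x ⊞ (⊟ y)) ⊞ y ≡ x
  ⊟-⊞-cancelʳ x y = trans (R.+-assoc x (⊟ y) y) (trans (cong (x ⊞_) (R.-‿inverseˡ y)) (R.+-identityʳ x))

  ⊞-absorbs⇒≡0 : ∀ x y → x ⊞ y ≡ y → x ≡ 0#
  ⊞-absorbs⇒≡0 x y x+y≡y = trans (sym (⊞-⊟-cancelʳ x y)) (trans (cong (_⊞ (⊟ y)) x+y≡y) (R.-‿inverseʳ y))

  q : ℕ
  q = order

  q-1 : ℕ
  q-1 = q ∸ 1

  ∑-δ : ∀ z (h : Carrier → ℕ) → ∑ elements (λ y → 𝟙 (z ≟ y) * h y) ≡ h z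
  ∑-δ z h = go elements elements-unique (elements-complete z)
    where
    vanish : ∀ ys → All (z ≢_) ys → ∑ ys (λ y → 𝟙 (z ≟ y) * h y) ≡ 0
    vanish []       []           = refl
    vanish (y ∷ ys) (z≢y ∷ z≢ys) = cong₂ _+_ (cong (_* h y) (𝟙-no (z ≟ y) z≢y)) (vanish ys z≢ys)
    go : ∀ ys → Unique ys → z ∈ ys → ∑ ys (λ y → 𝟙 (z ≟ y) * h y) ≡ h z
    go (y ∷ ys) (z≢ys ∷ _) (here refl) =
      trans (cong₂ _+_ (trans (cong (_* h z) (𝟙-yes (z ≟ z) refl)) (+-identityʳ (h z))) (vanish ys z≢ys)) (+-identityʳ (h z))
    go (y ∷ ys) (y≢ys ∷ ys!) (there z∈ys) =
      cong₂ _+_ (cong (_* h y) (𝟙-no (z ≟ y) (λ { refl → All.lookup y≢ys z∈ys refl }))) (go ys ys! z∈ys)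

  count-≡ : ∀ z → count (z ≟_) elements ≡ 1
  count-≡ z = trans (∑-cong elements (λ y → sym (*-identityʳ (𝟙 (z ≟ y))))) (∑-δ z (λ _ → 1))

  ∑-elements-bijection : (σ τ : Carrier → Carrier) → (∀ x → τ (σ x) ≡ x) → (∀ y → σ (τ y) ≡ y) →
    (h : Carrier → ℕ) → ∑ elements (λ x → h (σ x)) ≡ ∑ elements h
  ∑-elements-bijection σ τ τσ στ h = begin
    ∑ elements (λ x → h (σ x))
      ≡⟨ ∑-cong elements (λ x → sym (∑-δ (σ x) h)) ⟩
    ∑ elements (λ x → ∑ elements (λ y → 𝟙 (σ x ≟ y) * h y))
      ≡⟨ ∑-comm elements elements _ ⟩
    ∑ elements (λ y → ∑ elements (λ x → 𝟙 (σ x ≟ y) * h y))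
      ≡⟨ ∑-cong elements (λ y → trans (∑-cong elements (λ x → *-comm _ (h y))) (∑-*ˡ elements (h y) _)) ⟩
    ∑ elements (λ y → h y * count (λ x → σ x ≟ y) elements)
      ≡⟨ ∑-cong elements (λ y → cong (h y *_) (preimage y)) ⟩
    ∑ elements (λ y → h y * 1)
      ≡⟨ ∑-cong elements (λ y → *-identityʳ (h y)) ⟩
    ∑ elements h ∎
    where
    open ≡-Reasoning
    preimage : ∀ y → count (λ x → σ x ≟ y) elements ≡ 1
    preimage y = trans (∑-cong elements (λ x → 𝟙-cong (to x) (from x) (σ x ≟ y) (τ y ≟ x))) (count-≡ (τ y))
      where
      to : ∀ x → σ x ≡ y → τ y ≡ x
      to x σx≡y = trans (cong τ (sym σx≡y)) (τσ x)
      from : ∀ x → τ y ≡ x → σ x ≡ y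
      from x τy≡x = trans (cong σ (sym τy≡x)) (στ y)

  2≤q : 2 ≤ q
  2≤q = begin
    2                                               ≡⟨ sym (cong₂ _+_ (count-≡ 0#) (count-≡ 1#)) ⟩
    count (0# ≟_) elements + count (1# ≟_) elements ≡⟨ sym (∑-+ elements _ _) ⟩
    ∑ elements (λ y → 𝟙 (0# ≟ y) + 𝟙 (1# ≟ y))      ≤⟨ ∑-mono elements 0-or-1≤1 ⟩
    ∑ elements (λ _ → 1)                            ≡⟨ trans (∑-const elements 1) (*-identityʳ q) ⟩
    q                                               ∎
    where
    open ≤-Reasoning
    0-or-1≤1 : ∀ y → 𝟙 (0# ≟ y) + 𝟙 (1# ≟ y) ≤ 1
    0-or-1≤1 y with 0# ≟ y | 1# ≟ y
    ... | yes refl | yes 1≡0 = ⊥-elim (0≢1 (sym 1≡0))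
    ... | yes _    | no _    = ≤-refl
    ... | no _     | yes _   = ≤-refl
    ... | no _     | no _    = z≤n

  q≡1+q-1 : q ≡ suc q-1
  q≡1+q-1 = sym (m+[n∸m]≡n (≤-trans (s≤s z≤n) 2≤q))

  1≤q-1 : 1 ≤ q-1
  1≤q-1 = ∸-monoˡ-≤ 1 2≤q

  instance
    q-nonZero : ℕ.NonZero q
    q-nonZero = >-nonZero (≤-trans (s≤s z≤n) 2≤q)

    q-1-nonZero : ℕ.NonZero q-1
    q-1-nonZero = >-nonZero 1≤q-1

  count-≢0 : count (λ x → ¬? (0# ≟ x)) elements ≡ q-1
  count-≢0 = suc-injective (begin
    suc (count (λ x → ¬? (0# ≟ x)) elements)
      ≡⟨ cong (_+ count (λ x → ¬? (0# ≟ x)) elements) (sym (count-≡ 0#)) ⟩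
    count (0# ≟_) elements + count (λ x → ¬? (0# ≟ x)) elements
      ≡⟨ sym (∑-+ elements _ _) ⟩
    ∑ elements (λ x → 𝟙 (0# ≟ x) + 𝟙 (¬? (0# ≟ x)))
      ≡⟨ ∑-cong elements excluded-middle ⟩
    ∑ elements (λ _ → 1)
      ≡⟨ trans (∑-const elements 1) (*-identityʳ q) ⟩
    q
      ≡⟨ q≡1+q-1 ⟩
    suc q-1 ∎)
    where
    open ≡-Reasoning
    excluded-middle : ∀ x → 𝟙 (0# ≟ x) + 𝟙 (¬? (0# ≟ x)) ≡ 1
    excluded-middle x with 0# ≟ x
    ... | yes _ = refl
    ... | no _  = refl

  -- Dual vectors are Vec rather than Fin k → Carrier, so that F^k can be enumerated and
  -- compared with ≡ without function extensionality.
  V : ℕ → Set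
  V = Vec Carrier

  vectors : ∀ k → List (V k)
  vectors zero    = [] ∷ []
  vectors (suc k) = cartesianProductWith _∷_ elements (vectors k)

  ∈-vectors : ∀ {k} (a : V k) → a ∈ vectors k
  ∈-vectors []      = here refl
  ∈-vectors (x ∷ a) = ∈-cartesianProductWith⁺ _∷_ (elements-complete x) (∈-vectors a)

  ∑-vectors-suc : ∀ k (f : V (suc k) → ℕ) → ∑ (vectors (suc k)) f ≡ ∑ elements (λ x → ∑ (vectors k) (λ a → f (x ∷ a)))
  ∑-vectors-suc k f = ∑-cartesianProductWith _∷_ elements (vectors k) f

  ∑-vectors-1 : ∀ k → ∑ (vectors k) (λ _ → 1) ≡ q ^ k
  ∑-vectors-1 zero    = refl
  ∑-vectors-1 (suc k) = begin
    ∑ (vectors (suc k)) (λ _ → 1)                 ≡⟨ ∑-vectors-suc k _ ⟩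
    ∑ elements (λ _ → ∑ (vectors k) (λ _ → 1))    ≡⟨ ∑-cong elements (λ _ → ∑-vectors-1 k) ⟩
    ∑ elements (λ _ → q ^ k)                      ≡⟨ ∑-const elements (q ^ k) ⟩
    q ^ suc k                                     ∎
    where open ≡-Reasoning

  infixl 6 _⊞ᵛ_
  infixl 7 _⊠ᵛ_

  _⊞ᵛ_ : ∀ {k} → V k → V k → V k
  _⊞ᵛ_ = zipWith _⊞_

  _⊠ᵛ_ : ∀ {k} → Carrier → V k → V k
  c ⊠ᵛ a = Vec.map (c ⊠_) a

  0ᵛ : ∀ {k} → V k
  0ᵛ = replicate _ 0#

  ∑-vectors-translate : ∀ {k} (b : V k) (f : V k → ℕ) → ∑ (vectors k) (λ a → f (a ⊞ᵛ b)) ≡ ∑ (vectors k) f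
  ∑-vectors-translate []      f = refl
  ∑-vectors-translate {suc k} (y ∷ b) f = begin
    ∑ (vectors (suc k)) (λ a → f (a ⊞ᵛ (y ∷ b)))
      ≡⟨ ∑-vectors-suc k _ ⟩
    ∑ elements (λ x → ∑ (vectors k) (λ a → f ((x ⊞ y) ∷ (a ⊞ᵛ b))))
      ≡⟨ ∑-cong elements (λ x → ∑-vectors-translate b (λ a → f ((x ⊞ y) ∷ a))) ⟩
    ∑ elements (λ x → ∑ (vectors k) (λ a → f ((x ⊞ y) ∷ a)))
      ≡⟨ ∑-elements-bijection (_⊞ y) (_⊞ (⊟ y)) (λ x → ⊞-⊟-cancelʳ x y) (λ x → ⊟-⊞-cancelʳ x y) _ ⟩
    ∑ elements (λ x → ∑ (vectors k) (λ a → f (x ∷ a)))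
      ≡⟨ sym (∑-vectors-suc k f) ⟩
    ∑ (vectors (suc k)) f ∎
    where open ≡-Reasoning

  ∑-vectors-scale : ∀ {k} c → c ≢ 0# → (f : V k → ℕ) → ∑ (vectors k) (λ a → f (c ⊠ᵛ a)) ≡ ∑ (vectors k) f
  ∑-vectors-scale {zero}  c c≢0 f = refl
  ∑-vectors-scale {suc k} c c≢0 f = begin
    ∑ (vectors (suc k)) (λ a → f (c ⊠ᵛ a))
      ≡⟨ ∑-vectors-suc k _ ⟩
    ∑ elements (λ x → ∑ (vectors k) (λ a → f ((c ⊠ x) ∷ c ⊠ᵛ a)))
      ≡⟨ ∑-cong elements (λ x → ∑-vectors-scale c c≢0 (λ a → f ((c ⊠ x) ∷ a))) ⟩
    ∑ elements (λ x → ∑ (vectors k) (λ a → f ((c ⊠ x) ∷ a)))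
      ≡⟨ ∑-elements-bijection (c ⊠_) (inv c c≢0 ⊠_) (inv-cancelˡ c c≢0) (inv-cancelʳ c c≢0) _ ⟩
    ∑ elements (λ x → ∑ (vectors k) (λ a → f (x ∷ a)))
      ≡⟨ sym (∑-vectors-suc k f) ⟩
    ∑ (vectors (suc k)) f ∎
    where open ≡-Reasoning

  q-1∣∑-vectors : ∀ {k} (f : V k → ℕ) → (∀ c a → c ≢ 0# → f (c ⊠ᵛ a) ≡ f a) → f 0ᵛ ≡ 0 → q-1 ∣ ∑ (vectors k) f
  q-1∣∑-vectors {zero}  f f-scale f0≡0 = divides 0 (trans (+-identityʳ (f [])) f0≡0)
  q-1∣∑-vectors {suc k} f f-scale f0≡0 =
    subst (q-1 ∣_) (sym decomposition) (∣m∣n⇒∣m+n g0-divisible (n∣m*n N))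
    where
    g : Carrier → ℕ
    g x = ∑ (vectors k) (λ a → f (x ∷ a))
    N : ℕ
    N = g 1#
    g0-divisible : q-1 ∣ g 0#
    g0-divisible = q-1∣∑-vectors (λ a → f (0# ∷ a))
      (λ c a c≢0 → trans (cong (λ z → f (z ∷ c ⊠ᵛ a)) (sym (R.zeroʳ c))) (f-scale c (0# ∷ a) c≢0)) f0≡0
    g-nonzero : ∀ x → x ≢ 0# → g x ≡ N
    g-nonzero x x≢0 = begin
      ∑ (vectors k) (λ a → f (x ∷ a))
        ≡⟨ sym (∑-vectors-scale x x≢0 (λ a → f (x ∷ a))) ⟩
      ∑ (vectors k) (λ a → f (x ∷ x ⊠ᵛ a))
        ≡⟨ ∑-cong (vectors k) (λ a → trans (cong (λ z → f (z ∷ x ⊠ᵛ a)) (sym (R.*-identityʳ x))) (f-scale x (1# ∷ a) x≢0)) ⟩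
      N ∎
      where open ≡-Reasoning
    split : ∀ x → g x ≡ 𝟙 (0# ≟ x) * g x + 𝟙 (¬? (0# ≟ x)) * N
    split x with 0# ≟ x
    ... | yes _   = sym (trans (+-identityʳ _) (+-identityʳ _))
    ... | no 0≢x  = trans (g-nonzero x (λ x≡0 → 0≢x (sym x≡0))) (sym (+-identityʳ N))
    decomposition : ∑ (vectors (suc k)) f ≡ g 0# + N * q-1
    decomposition = begin
      ∑ (vectors (suc k)) f
        ≡⟨ ∑-vectors-suc k f ⟩
      ∑ elements g
        ≡⟨ ∑-cong elements split ⟩
      ∑ elements (λ x → 𝟙 (0# ≟ x) * g x + 𝟙 (¬? (0# ≟ x)) * N)
        ≡⟨ ∑-+ elements _ _ ⟩
      ∑ elements (λ x → 𝟙 (0# ≟ x) * g x) + ∑ elements (λ x → 𝟙 (¬? (0# ≟ x)) * N)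
        ≡⟨ cong₂ _+_ (∑-δ 0# g) (∑-cong elements (λ x → *-comm _ N)) ⟩
      g 0# + ∑ elements (λ x → N * 𝟙 (¬? (0# ≟ x)))
        ≡⟨ cong (g 0# +_) (trans (∑-*ˡ elements N _) (cong (N *_) count-≢0)) ⟩
      g 0# + N * q-1 ∎
      where open ≡-Reasoning

  ⟪_,_⟫ : ∀ {k} → V k → Vecᶠ F k → Carrier
  ⟪ a , v ⟫ = dot F (lookup a) v

  ⟪⟫-⊞ᵛ : ∀ {k} (a b : V k) v → ⟪ a ⊞ᵛ b , v ⟫ ≡ ⟪ a , v ⟫ ⊞ ⟪ b , v ⟫
  ⟪⟫-⊞ᵛ []      []      v = sym (R.+-identityʳ 0#)
  ⟪⟫-⊞ᵛ (x ∷ a) (y ∷ b) v =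
    trans (cong₂ _⊞_ (R.distribʳ (v zero) x y) (⟪⟫-⊞ᵛ a b (λ i → v (suc i)))) (⊞-interchange _ _ _ _)

  ⟪⟫-⊠ᵛ : ∀ {k} c (a : V k) v → ⟪ c ⊠ᵛ a , v ⟫ ≡ c ⊠ ⟪ a , v ⟫
  ⟪⟫-⊠ᵛ c []      v = sym (R.zeroʳ c)
  ⟪⟫-⊠ᵛ c (x ∷ a) v =
    trans (cong₂ _⊞_ (R.*-assoc c x (v zero)) (⟪⟫-⊠ᵛ c a (λ i → v (suc i)))) (sym (R.distribˡ c _ _))

  ⟪0ᵛ⟫ : ∀ {k} v → ⟪ 0ᵛ {k} , v ⟫ ≡ 0#
  ⟪0ᵛ⟫ {zero}  v = refl
  ⟪0ᵛ⟫ {suc k} v = trans (cong₂ _⊞_ (R.zeroˡ (v zero)) (⟪0ᵛ⟫ (λ i → v (suc i)))) (R.+-identityʳ 0#)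

  ≢0ᵛ⇒NonZero : ∀ {k} (a : V k) → a ≢ 0ᵛ → NonZero F (lookup a)
  ≢0ᵛ⇒NonZero []      a≢0 _       = a≢0 refl
  ≢0ᵛ⇒NonZero (x ∷ a) a≢0 all≡0 =
    ≢0ᵛ⇒NonZero a (λ a≡0 → a≢0 (cong₂ _∷_ (all≡0 zero) a≡0)) (λ i → all≡0 (suc i))

  ⊠ᵛ-0ᵛ : ∀ {k} c → c ⊠ᵛ 0ᵛ {k} ≡ 0ᵛ
  ⊠ᵛ-0ᵛ {zero}  c = refl
  ⊠ᵛ-0ᵛ {suc k} c = cong₂ _∷_ (R.zeroʳ c) (⊠ᵛ-0ᵛ c)

  ⊠ᵛ-cancel-≡0ᵛ : ∀ {k} c (a : V k) → c ≢ 0# → c ⊠ᵛ a ≡ 0ᵛ → a ≡ 0ᵛ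
  ⊠ᵛ-cancel-≡0ᵛ c []      c≢0 _     = refl
  ⊠ᵛ-cancel-≡0ᵛ c (x ∷ a) c≢0 ca≡0 with ∷-injective ca≡0
  ... | cx≡0 , ca'≡0 = cong₂ _∷_ (⊠-cancel-≡0 c c≢0 x cx≡0) (⊠ᵛ-cancel-≡0ᵛ c a c≢0 ca'≡0)

  _≟ᵛ_ : ∀ {k} → (a b : V k) → Dec (a ≡ b)
  _≟ᵛ_ = ≡-dec _≟_

  count-≡0ᵛ : ∀ k → count (_≟ᵛ 0ᵛ) (vectors k) ≡ 1
  count-≡0ᵛ zero    = refl
  count-≡0ᵛ (suc k) = begin
    count (_≟ᵛ 0ᵛ) (vectors (suc k))
      ≡⟨ ∑-vectors-suc k _ ⟩
    ∑ elements (λ x → ∑ (vectors k) (λ a → 𝟙 ((x ∷ a) ≟ᵛ 0ᵛ)))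
      ≡⟨ ∑-cong elements (λ x → ∑-cong (vectors k) (λ a → split x a)) ⟩
    ∑ elements (λ x → ∑ (vectors k) (λ a → 𝟙 (0# ≟ x) * 𝟙 (a ≟ᵛ 0ᵛ)))
      ≡⟨ ∑-cong elements (λ x → trans (∑-*ˡ (vectors k) (𝟙 (0# ≟ x)) (λ a → 𝟙 (a ≟ᵛ 0ᵛ))) (cong (𝟙 (0# ≟ x) *_) (count-≡0ᵛ k))) ⟩
    ∑ elements (λ x → 𝟙 (0# ≟ x) * 1)
      ≡⟨ ∑-δ 0# (λ _ → 1) ⟩
    1 ∎
    where
    open ≡-Reasoning
    split : ∀ x (a : V k) → 𝟙 ((x ∷ a) ≟ᵛ 0ᵛ) ≡ 𝟙 (0# ≟ x) * 𝟙 (a ≟ᵛ 0ᵛ)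
    split x a = trans (𝟙-cong to from _ (0# ≟ x ×-dec a ≟ᵛ 0ᵛ)) (𝟙-× (0# ≟ x) (a ≟ᵛ 0ᵛ))
      where
      to : x ∷ a ≡ 0ᵛ → 0# ≡ x × a ≡ 0ᵛ
      to eq = let x≡0 , a≡0 = ∷-injective eq in sym x≡0 , a≡0
      from : 0# ≡ x × a ≡ 0ᵛ → x ∷ a ≡ 0ᵛ
      from (0≡x , a≡0) = cong₂ _∷_ (sym 0≡x) a≡0

-- Hyperplanes through subspaces spanned by points of a projective system

-- For n = (s + 1)(q + 1) + κ points and a set S with |S⊥| = w = q²u and t = κ + 1 + f points of G
-- in ⟨S⟩, with I the incidences, X the deficiency and W = w - 1: eliminating I and W leaves
-- X = s q + (q - 1) - q u s - q u f (q - 1), stated here without subtraction.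
deficiency-identity : ∀ q s κ u f {n t w} I X W →
  n ≡ (s + 1) * (q + 1) + κ → t ≡ suc κ + f → w ≡ q * (q * u) →
  I + X ≡ W * (2 + κ + s) + n → q * I + t * w ≡ n * w + t * (q * w) → W + 1 ≡ w →
  q * u * s + q * u * f * (q ∸ 1) + X ≡ s * q + (q ∸ 1)
deficiency-identity zero    s κ u f I X W refl refl refl _ _ W+1≡0 = ⊥-elim (1+n≢0 (trans (+-comm 1 W) W+1≡0))
deficiency-identity (suc p) s κ u f I X W refl refl refl I+X≡ incidences W+1≡w =
  *-cancelˡ-≡ (A + X) B q (+-cancelˡ-≡ P _ _ (begin
    P + q * (A + X)                     ≡⟨ distribute P q A X ⟩
    P + q * X + q * A                   ≡⟨ cong (_+ q * A) eliminate-I-and-W ⟩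
    q * (w * m) + q * n + t * w + q * A ≡⟨ polynomial p u s κ f ⟩
    P + q * B                           ∎))
  where
  open ≡-Reasoning
  q m n t w A B P : ℕ
  q = suc p
  m = 2 + κ + s
  n = (s + 1) * (q + 1) + κ
  t = suc κ + f
  w = q * (q * u)
  A = q * u * s + q * u * f * p
  B = s * q + p
  P = n * w + t * (q * w) + q * m
  distribute : ∀ P q A X → P + q * (A + X) ≡ P + q * X + q * A
  distribute = solve-∀
  eliminate-I-and-W : P + q * X ≡ q * (w * m) + q * n + t * w
  eliminate-I-and-W = begin
    P + q * X                          ≡⟨ regroup₁ (n * w) (t * (q * w)) (q * m) (q * X) ⟩
    n * w + t * (q * w) + q * X + q * m ≡⟨ cong (λ z → z + q * X + q * m) (sym incidences) ⟩
    q * I + t * w + q * X + q * m       ≡⟨ regroup₂ q I X m (t * w) ⟩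
    q * (I + X) + q * m + t * w         ≡⟨ cong (λ z → q * z + q * m + t * w) I+X≡ ⟩
    q * (W * m + n) + q * m + t * w     ≡⟨ regroup₃ q W m n (t * w) ⟩
    q * ((W + 1) * m) + q * n + t * w   ≡⟨ cong (λ z → q * (z * m) + q * n + t * w) W+1≡w ⟩
    q * (w * m) + q * n + t * w         ∎
    where
    regroup₁ : ∀ a b c d → a + b + c + d ≡ a + b + d + c
    regroup₁ = solve-∀
    regroup₂ : ∀ q I X m b → q * I + b + q * X + q * m ≡ q * (I + X) + q * m + b
    regroup₂ = solve-∀
    regroup₃ : ∀ q W m n b → q * (W * m + n) + q * m + b ≡ q * ((W + 1) * m) + q * n + b
    regroup₃ = solve-∀
  polynomial : ∀ p u s κ f →
    let q = suc p ; m = 2 + κ + s ; n = (s + 1) * (q + 1) + κ ; t = suc κ + f ; w = q * (q * u) in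
    q * (w * m) + q * n + t * w + q * (q * u * s + q * u * f * p)
      ≡ n * w + t * (q * w) + q * m + q * (s * q + p)
  polynomial = solve-∀

deficiency-identity⇒f≡0 : ∀ q s u f X → 2 ≤ q → 1 ≤ u →
  q * u * s + q * u * f * (q ∸ 1) + X ≡ s * q + (q ∸ 1) → f ≡ 0
deficiency-identity⇒f≡0 q             s u       zero    X _         _         _  = refl
deficiency-identity⇒f≡0 (suc zero)    s u       (suc f) X (s≤s ())  _         _
deficiency-identity⇒f≡0 (suc (suc p)) s zero    (suc f) X _         ()        _
deficiency-identity⇒f≡0 (suc (suc p)) s (suc u) (suc f) X _ _ eq =
  ⊥-elim (m≢m+1+n _ (trans (sym eq) (overshoot p u f s X)))
  where
  m≢m+1+n : ∀ a {b} → a ≢ a + suc b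
  m≢m+1+n a {b} a≡a+1+b = 1+n≢0 (sym (+-cancelˡ-≡ a 0 (suc b) (trans (+-identityʳ a) a≡a+1+b)))
  overshoot : ∀ p u f s X → let q = suc (suc p) in
    q * suc u * s + q * suc u * suc f * suc p + X
      ≡ (s * q + suc p) + suc (p * p + 2 * p + q * suc p * (u * f + u + f) + q * u * s + X)
  overshoot = solve-∀

deficiency-identity⇒X≡q-1 : ∀ q s X → q * 1 * s + q * 1 * 0 * (q ∸ 1) + X ≡ s * q + (q ∸ 1) → X ≡ q ∸ 1
deficiency-identity⇒X≡q-1 q s X eq = +-cancelˡ-≡ (s * q) X (q ∸ 1) (trans (cong (_+ X) (sym (simplify q s (q ∸ 1)))) eq)
  where
  simplify : ∀ q s r → q * 1 * s + q * 1 * 0 * r ≡ s * q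
  simplify = solve-∀

module ProjectiveSystemCounting (F : FiniteField) {k : ℕ} (G : List (Vecᶠ F k)) where

  open FiniteField F renaming (_+_ to _⊞_; _*_ to _⊠_; -_ to ⊟_)
  open FiniteFieldSums F
  private module R = IsCommutativeRing isCommutativeRing

  Point : Set
  Point = Vecᶠ F k

  pointsOn : V k → ℕ
  pointsOn a = hyperplaneCount F (lookup a) G

  pointsOn≡count : ∀ a → pointsOn a ≡ count (λ v → ⟪ a , v ⟫ ≟ 0#) G
  pointsOn≡count a = length-filter (λ v → ⟪ a , v ⟫ ≟ 0#) G

  infix 4 _⊥_ _⊥?_

  _⊥_ : V k → List Point → Set
  a ⊥ S = All (λ u → ⟪ a , u ⟫ ≡ 0#) S

  _⊥?_ : ∀ a S → Dec (a ⊥ S)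
  a ⊥? S = All.all? (λ u → ⟪ a , u ⟫ ≟ 0#) S

  ⊥-⊞ᵛ : ∀ a b {S} → a ⊥ S → b ⊥ S → a ⊞ᵛ b ⊥ S
  ⊥-⊞ᵛ a b []             []             = []
  ⊥-⊞ᵛ a b {u ∷ S} (au≡0 ∷ a⊥S) (bu≡0 ∷ b⊥S) =
    trans (⟪⟫-⊞ᵛ a b u) (trans (cong₂ _⊞_ au≡0 bu≡0) (R.+-identityʳ 0#)) ∷ ⊥-⊞ᵛ a b a⊥S b⊥S

  ⊥-⊞ᵛ⁻ : ∀ a b {S} → b ⊥ S → a ⊞ᵛ b ⊥ S → a ⊥ S
  ⊥-⊞ᵛ⁻ a b []             []               = []
  ⊥-⊞ᵛ⁻ a b {u ∷ S} (bu≡0 ∷ b⊥S) (abu≡0 ∷ ab⊥S) =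
    ⊞-absorbs⇒≡0 _ 0# (trans (trans (cong (⟪ a , u ⟫ ⊞_) (sym bu≡0)) (sym (⟪⟫-⊞ᵛ a b u))) abu≡0)
      ∷ ⊥-⊞ᵛ⁻ a b b⊥S ab⊥S

  ⊥-⊠ᵛ : ∀ {S} c a → a ⊥ S → c ⊠ᵛ a ⊥ S
  ⊥-⊠ᵛ c a = All.map (λ {u} au≡0 → trans (⟪⟫-⊠ᵛ c a u) (trans (cong (c ⊠_) au≡0) (R.zeroʳ c)))

  ⊥-⊠ᵛ⁻ : ∀ {S} c a → c ≢ 0# → c ⊠ᵛ a ⊥ S → a ⊥ S
  ⊥-⊠ᵛ⁻ c a c≢0 = All.map (λ {u} cau≡0 → ⊠-cancel-≡0 c c≢0 _ (trans (sym (⟪⟫-⊠ᵛ c a u)) cau≡0))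

  annihilatorSize : List Point → ℕ
  annihilatorSize S = count (_⊥? S) (vectors k)

  -- v lies in the span of S, expressed through the annihilator of S so that it is decidable.
  InSpan : List Point → Point → Set
  InSpan S v = ∀ a → a ⊥ S → ⟪ a , v ⟫ ≡ 0#

  Separated : List Point → Point → Set
  Separated S v = ∃ λ a → a ⊥ S × ⟪ a , v ⟫ ≢ 0#

  private
    implication? : ∀ S v a → Dec (a ⊥ S → ⟪ a , v ⟫ ≡ 0#)
    implication? S v a = (a ⊥? S) →-dec (⟪ a , v ⟫ ≟ 0#)

  inSpan⊎separated : ∀ S v → InSpan S v ⊎ Separated S v
  inSpan⊎separated S v with All.all? (implication? S v) (vectors k)
  ... | yes all = inj₁ (λ a → All.lookup all (∈-vectors a))
  ... | no ¬all with satisfied (¬All⇒Any¬ (implication? S v) (vectors k) ¬all)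
  ...   | a , ¬impl with a ⊥? S
  ...     | yes a⊥S = inj₂ (a , a⊥S , λ av≡0 → ¬impl (λ _ → av≡0))
  ...     | no ¬a⊥S = ⊥-elim (¬impl (λ a⊥S → ⊥-elim (¬a⊥S a⊥S)))

  InSpan? : ∀ S v → Dec (InSpan S v)
  InSpan? S v with inSpan⊎separated S v
  ... | inj₁ inSpan              = yes inSpan
  ... | inj₂ (a , a⊥S , av≢0)    = no (λ inSpan → av≢0 (inSpan a a⊥S))

  spanCount : List Point → ℕ
  spanCount S = count (InSpan? S) G

  fibre : List Point → Point → Carrier → ℕ
  fibre S v x = count (λ a → (a ⊥? S) ×-dec (⟪ a , v ⟫ ≟ x)) (vectors k)

  ∑-fibre : ∀ S v → ∑ elements (fibre S v) ≡ annihilatorSize S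
  ∑-fibre S v = begin
    ∑ elements (fibre S v)                                                     ≡⟨ ∑-comm elements (vectors k) _ ⟩
    ∑ (vectors k) (λ a → ∑ elements (λ x → 𝟙 ((a ⊥? S) ×-dec (⟪ a , v ⟫ ≟ x)))) ≡⟨ ∑-cong (vectors k) one-value ⟩
    annihilatorSize S                                                          ∎
    where
    open ≡-Reasoning
    one-value : ∀ a → ∑ elements (λ x → 𝟙 ((a ⊥? S) ×-dec (⟪ a , v ⟫ ≟ x))) ≡ 𝟙 (a ⊥? S)
    one-value a = begin
      ∑ elements (λ x → 𝟙 ((a ⊥? S) ×-dec (⟪ a , v ⟫ ≟ x))) ≡⟨ ∑-cong elements (λ x → 𝟙-× (a ⊥? S) (⟪ a , v ⟫ ≟ x)) ⟩
      ∑ elements (λ x → 𝟙 (a ⊥? S) * 𝟙 (⟪ a , v ⟫ ≟ x))     ≡⟨ ∑-*ˡ elements (𝟙 (a ⊥? S)) _ ⟩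
      𝟙 (a ⊥? S) * count (⟪ a , v ⟫ ≟_) elements           ≡⟨ cong (𝟙 (a ⊥? S) *_) (count-≡ ⟪ a , v ⟫) ⟩
      𝟙 (a ⊥? S) * 1                                       ≡⟨ *-identityʳ _ ⟩
      𝟙 (a ⊥? S)                                           ∎

  fibre-0# : ∀ S v → fibre S v 0# ≡ annihilatorSize (v ∷ S)
  fibre-0# S v = ∑-cong (vectors k) (λ a →
    𝟙-cong (λ (a⊥S , av≡0) → av≡0 ∷ a⊥S) (λ { (av≡0 ∷ a⊥S) → a⊥S , av≡0 }) _ (a ⊥? v ∷ S))

  -- Translating by a suitable multiple of a separating a₀ moves the fibre over 0 onto any other fibre.
  fibre-translate : ∀ {S v} a₀ → a₀ ⊥ S → ⟪ a₀ , v ⟫ ≢ 0# → ∀ x → fibre S v x ≡ fibre S v 0#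
  fibre-translate {S} {v} a₀ a₀⊥S a₀v≢0 x =
    trans (sym (∑-vectors-translate b _)) (∑-cong (vectors k) (λ a → 𝟙-cong (to a) (from a) _ _))
    where
    b : V k
    b = (x ⊠ inv ⟪ a₀ , v ⟫ a₀v≢0) ⊠ᵛ a₀
    b⊥S : b ⊥ S
    b⊥S = ⊥-⊠ᵛ _ a₀ a₀⊥S
    bv≡x : ⟪ b , v ⟫ ≡ x
    bv≡x = trans (⟪⟫-⊠ᵛ _ a₀ v) (trans (R.*-assoc x _ _) (trans (cong (x ⊠_) (⊠-inverseˡ _ a₀v≢0)) (R.*-identityʳ x)))
    to : ∀ a → a ⊞ᵛ b ⊥ S × ⟪ a ⊞ᵛ b , v ⟫ ≡ x → a ⊥ S × ⟪ a , v ⟫ ≡ 0#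
    to a (ab⊥S , abv≡x) =
      ⊥-⊞ᵛ⁻ a b b⊥S ab⊥S , ⊞-absorbs⇒≡0 _ x (trans (sym (trans (⟪⟫-⊞ᵛ a b v) (cong (⟪ a , v ⟫ ⊞_) bv≡x))) abv≡x)
    from : ∀ a → a ⊥ S × ⟪ a , v ⟫ ≡ 0# → a ⊞ᵛ b ⊥ S × ⟪ a ⊞ᵛ b , v ⟫ ≡ x
    from a (a⊥S , av≡0) = ⊥-⊞ᵛ a b a⊥S b⊥S , trans (⟪⟫-⊞ᵛ a b v) (trans (cong₂ _⊞_ av≡0 bv≡x) (R.+-identityˡ x))

  annihilatorSize-∷-inSpan : ∀ {S v} → InSpan S v → annihilatorSize (v ∷ S) ≡ annihilatorSize S
  annihilatorSize-∷-inSpan {S} {v} inSpan = ∑-cong (vectors k) (λ a →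
    𝟙-cong (λ { (_ ∷ a⊥S) → a⊥S }) (λ a⊥S → inSpan a a⊥S ∷ a⊥S) (a ⊥? v ∷ S) (a ⊥? S))

  annihilatorSize-∷-separated : ∀ {S v} a₀ → a₀ ⊥ S → ⟪ a₀ , v ⟫ ≢ 0# → q * annihilatorSize (v ∷ S) ≡ annihilatorSize S
  annihilatorSize-∷-separated {S} {v} a₀ a₀⊥S a₀v≢0 = begin
    q * annihilatorSize (v ∷ S)
      ≡⟨ sym (∑-const elements _) ⟩
    ∑ elements (λ _ → annihilatorSize (v ∷ S))
      ≡⟨ ∑-cong elements (λ x → sym (trans (fibre-translate a₀ a₀⊥S a₀v≢0 x) (fibre-0# S v))) ⟩
    ∑ elements (fibre S v)
      ≡⟨ ∑-fibre S v ⟩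
    annihilatorSize S ∎
    where open ≡-Reasoning

  annihilatorSize-power : ∀ S → ∃ λ e → annihilatorSize S ≡ q ^ e × k ≤ e + length S
  annihilatorSize-power []      = k , ∑-vectors-1 k , ≤-reflexive (sym (+-identityʳ k))
  annihilatorSize-power (v ∷ S) with annihilatorSize-power S | inSpan⊎separated S v
  ... | e , |S⊥|≡qᵉ , k≤e+|S| | inj₁ inSpan =
    e , trans (annihilatorSize-∷-inSpan inSpan) |S⊥|≡qᵉ , ≤-trans k≤e+|S| (+-monoʳ-≤ e (n≤1+n _))
  ... | zero , |S⊥|≡1 , _ | inj₂ (a₀ , a₀⊥S , a₀v≢0) =
    ⊥-elim (<⇒≢ 2≤q (sym (m*n≡1⇒m≡1 q _ (trans (annihilatorSize-∷-separated a₀ a₀⊥S a₀v≢0) |S⊥|≡1))))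
  ... | suc e , |S⊥|≡qᵉ⁺¹ , k≤e+1+|S| | inj₂ (a₀ , a₀⊥S , a₀v≢0) =
    e , *-cancelˡ-≡ _ _ q (trans (annihilatorSize-∷-separated a₀ a₀⊥S a₀v≢0) |S⊥|≡qᵉ⁺¹)
      , ≤-trans k≤e+1+|S| (≤-reflexive (sym (+-suc e _)))

  incidences : List Point → ℕ
  incidences S = ∑ (vectors k) (λ a → 𝟙 (a ⊥? S) * pointsOn a)

  incidences≡∑annihilatorSize : ∀ S → incidences S ≡ ∑ G (λ v → annihilatorSize (v ∷ S))
  incidences≡∑annihilatorSize S = begin
    ∑ (vectors k) (λ a → 𝟙 (a ⊥? S) * pointsOn a)
      ≡⟨ ∑-cong (vectors k) expand ⟩
    ∑ (vectors k) (λ a → ∑ G (λ v → 𝟙 (a ⊥? S) * 𝟙 (⟪ a , v ⟫ ≟ 0#)))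
      ≡⟨ ∑-comm (vectors k) G _ ⟩
    ∑ G (λ v → ∑ (vectors k) (λ a → 𝟙 (a ⊥? S) * 𝟙 (⟪ a , v ⟫ ≟ 0#)))
      ≡⟨ ∑-cong G (λ v → trans (∑-cong (vectors k) (λ a → sym (𝟙-× (a ⊥? S) _))) (fibre-0# S v)) ⟩
    ∑ G (λ v → annihilatorSize (v ∷ S)) ∎
    where
    open ≡-Reasoning
    expand : ∀ a → 𝟙 (a ⊥? S) * pointsOn a ≡ ∑ G (λ v → 𝟙 (a ⊥? S) * 𝟙 (⟪ a , v ⟫ ≟ 0#))
    expand a = trans (cong (𝟙 (a ⊥? S) *_) (pointsOn≡count a)) (sym (∑-*ˡ G (𝟙 (a ⊥? S)) _))

  -- Each point of G meets S⊥ in all of S⊥ if it lies in ⟨S⟩ and in a 1/q fraction of it otherwise.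
  incidence-equation : ∀ S → let w = annihilatorSize S ; t = spanCount S in
    q * incidences S + t * w ≡ length G * w + t * (q * w)
  incidence-equation S = begin
    q * incidences S + t * w
      ≡⟨ cong₂ _+_ (cong (q *_) (incidences≡∑annihilatorSize S)) (sym (∑-*ʳ G w _)) ⟩
    q * ∑ G (λ v → annihilatorSize (v ∷ S)) + ∑ G (λ v → 𝟙 (InSpan? S v) * w)
      ≡⟨ cong (_+ ∑ G (λ v → 𝟙 (InSpan? S v) * w)) (sym (∑-*ˡ G q _)) ⟩
    ∑ G (λ v → q * annihilatorSize (v ∷ S)) + ∑ G (λ v → 𝟙 (InSpan? S v) * w)
      ≡⟨ sym (∑-+ G _ _) ⟩
    ∑ G (λ v → q * annihilatorSize (v ∷ S) + 𝟙 (InSpan? S v) * w)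
      ≡⟨ ∑-cong G per-point ⟩
    ∑ G (λ v → w + 𝟙 (InSpan? S v) * (q * w))
      ≡⟨ ∑-+ G _ _ ⟩
    ∑ G (λ _ → w) + ∑ G (λ v → 𝟙 (InSpan? S v) * (q * w))
      ≡⟨ cong₂ _+_ (∑-const G w) (∑-*ʳ G (q * w) _) ⟩
    length G * w + t * (q * w) ∎
    where
    open ≡-Reasoning
    w t : ℕ
    w = annihilatorSize S
    t = spanCount S
    per-point : ∀ v → q * annihilatorSize (v ∷ S) + 𝟙 (InSpan? S v) * w ≡ w + 𝟙 (InSpan? S v) * (q * w)
    per-point v = by-cases (inSpan⊎separated S v)
      where
      by-cases : InSpan S v ⊎ Separated S v → q * annihilatorSize (v ∷ S) + 𝟙 (InSpan? S v) * w ≡ w + 𝟙 (InSpan? S v) * (q * w)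
      by-cases (inj₁ inSpan) rewrite 𝟙-yes (InSpan? S v) inSpan | annihilatorSize-∷-inSpan inSpan =
        trans (+-comm (q * w) _) (cong₂ _+_ (*-identityˡ w) (sym (*-identityˡ (q * w))))
      by-cases (inj₂ (a₀ , a₀⊥S , a₀v≢0)) rewrite 𝟙-no (InSpan? S v) (λ inSpan → a₀v≢0 (inSpan a₀ a₀⊥S)) =
        cong (_+ 0) (annihilatorSize-∷-separated a₀ a₀⊥S a₀v≢0)

  nonzeroAnnihilator? : ∀ S a → Dec (a ⊥ S × a ≢ 0ᵛ)
  nonzeroAnnihilator? S a = (a ⊥? S) ×-dec ¬? (a ≟ᵛ 0ᵛ)

  nonzeroAnnihilators : List Point → ℕ
  nonzeroAnnihilators S = count (nonzeroAnnihilator? S) (vectors k)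

  0ᵛ⊥ : ∀ S → 0ᵛ ⊥ S
  0ᵛ⊥ S = All.tabulate (λ {u} _ → ⟪0ᵛ⟫ u)

  pointsOn-0ᵛ : pointsOn 0ᵛ ≡ length G
  pointsOn-0ᵛ = trans (pointsOn≡count 0ᵛ) (count-All (λ v → ⟪ 0ᵛ , v ⟫ ≟ 0#) (0ᵛ⊥ G))

  annihilatorSize≡nonzero+1 : ∀ S → annihilatorSize S ≡ nonzeroAnnihilators S + 1
  annihilatorSize≡nonzero+1 S =
    trans (∑-cong (vectors k) split) (trans (∑-+ (vectors k) _ _) (cong (nonzeroAnnihilators S +_) (count-≡0ᵛ k)))
    where
    split : ∀ a → 𝟙 (a ⊥? S) ≡ 𝟙 (nonzeroAnnihilator? S a) + 𝟙 (a ≟ᵛ 0ᵛ)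
    split a with a ≟ᵛ 0ᵛ | a ⊥? S
    ... | yes refl | yes _   = refl
    ... | yes refl | no ¬0⊥S = ⊥-elim (¬0⊥S (0ᵛ⊥ S))
    ... | no _     | yes _   = refl
    ... | no _     | no _    = refl

  deficiency : ℕ → List Point → ℕ
  deficiency m S = ∑ (vectors k) (λ a → 𝟙 (nonzeroAnnihilator? S a) * (m ∸ pointsOn a))

  incidences+deficiency : ∀ {m} → (∀ a → a ≢ 0ᵛ → pointsOn a ≤ m) →
    ∀ S → incidences S + deficiency m S ≡ nonzeroAnnihilators S * m + length G
  incidences+deficiency {m} pointsOn≤m S = begin
    incidences S + deficiency m S
      ≡⟨ sym (∑-+ (vectors k) _ _) ⟩
    ∑ (vectors k) (λ a → 𝟙 (a ⊥? S) * pointsOn a + 𝟙 (nonzero⊥? a) * (m ∸ pointsOn a))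
      ≡⟨ ∑-cong (vectors k) per-vector ⟩
    ∑ (vectors k) (λ a → 𝟙 (nonzero⊥? a) * m + 𝟙 (a ≟ᵛ 0ᵛ) * length G)
      ≡⟨ ∑-+ (vectors k) _ _ ⟩
    ∑ (vectors k) (λ a → 𝟙 (nonzero⊥? a) * m) + ∑ (vectors k) (λ a → 𝟙 (a ≟ᵛ 0ᵛ) * length G)
      ≡⟨ cong₂ _+_ (∑-*ʳ (vectors k) m _) (trans (∑-*ʳ (vectors k) (length G) _) (trans (cong (_* length G) (count-≡0ᵛ k)) (*-identityˡ _))) ⟩
    nonzeroAnnihilators S * m + length G ∎
    where
    open ≡-Reasoning
    nonzero⊥? : ∀ a → Dec (a ⊥ S × a ≢ 0ᵛ)
    nonzero⊥? = nonzeroAnnihilator? S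
    per-vector : ∀ a → 𝟙 (a ⊥? S) * pointsOn a + 𝟙 (nonzero⊥? a) * (m ∸ pointsOn a)
                     ≡ 𝟙 (nonzero⊥? a) * m + 𝟙 (a ≟ᵛ 0ᵛ) * length G
    per-vector a with a ≟ᵛ 0ᵛ | a ⊥? S
    ... | yes refl | yes _   = trans (+-identityʳ _) (trans (+-identityʳ _) (trans pointsOn-0ᵛ (sym (+-identityʳ _))))
    ... | yes refl | no ¬0⊥S = ⊥-elim (¬0⊥S (0ᵛ⊥ S))
    ... | no a≢0   | yes _   = begin
      pointsOn a + 0 + (m ∸ pointsOn a + 0) ≡⟨ cong₂ _+_ (+-identityʳ (pointsOn a)) (+-identityʳ (m ∸ pointsOn a)) ⟩
      pointsOn a + (m ∸ pointsOn a)         ≡⟨ m+[n∸m]≡n (pointsOn≤m a a≢0) ⟩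
      m                                     ≡⟨ sym (trans (+-identityʳ (m + 0)) (+-identityʳ m)) ⟩
      m + 0 + 0                             ∎
    ... | no _     | no _    = refl

  hyperplaneThrough? : {R : ℕ → Set} → (∀ x → Dec (R x)) → ∀ S a → Dec ((a ⊥ S × a ≢ 0ᵛ) × R (pointsOn a))
  hyperplaneThrough? R? S a = nonzeroAnnihilator? S a ×-dec R? (pointsOn a)

  -- Each hyperplane is counted q - 1 times, once for every nonzero normal vector.
  hyperplanesThrough : {R : ℕ → Set} → (∀ x → Dec (R x)) → List Point → ℕ
  hyperplanesThrough R? S = count (hyperplaneThrough? R? S) (vectors k)

  pointsOn-⊠ᵛ : ∀ c a → c ≢ 0# → pointsOn (c ⊠ᵛ a) ≡ pointsOn a
  pointsOn-⊠ᵛ c a c≢0 =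
    trans (pointsOn≡count (c ⊠ᵛ a)) (trans (∑-cong G (λ v → 𝟙-cong (to v) (from v) _ _)) (sym (pointsOn≡count a)))
    where
    to : ∀ v → ⟪ c ⊠ᵛ a , v ⟫ ≡ 0# → ⟪ a , v ⟫ ≡ 0#
    to v cav≡0 = ⊠-cancel-≡0 c c≢0 _ (trans (sym (⟪⟫-⊠ᵛ c a v)) cav≡0)
    from : ∀ v → ⟪ a , v ⟫ ≡ 0# → ⟪ c ⊠ᵛ a , v ⟫ ≡ 0#
    from v av≡0 = trans (⟪⟫-⊠ᵛ c a v) (trans (cong (c ⊠_) av≡0) (R.zeroʳ c))

  q-1∣hyperplanesThrough : ∀ {R : ℕ → Set} (R? : ∀ x → Dec (R x)) S → q-1 ∣ hyperplanesThrough R? S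
  q-1∣hyperplanesThrough {R} R? S =
    q-1∣∑-vectors (λ a → 𝟙 (hyperplaneThrough? R? S a)) scale-invariant (𝟙-no _ (λ ((_ , 0≢0) , _) → 0≢0 refl))
    where
    scale-invariant : ∀ c a → c ≢ 0# → 𝟙 (hyperplaneThrough? R? S (c ⊠ᵛ a)) ≡ 𝟙 (hyperplaneThrough? R? S a)
    scale-invariant c a c≢0 = 𝟙-cong
      (λ ((ca⊥S , ca≢0) , r) →
        (⊥-⊠ᵛ⁻ c a c≢0 ca⊥S , (λ a≡0 → ca≢0 (trans (cong (c ⊠ᵛ_) a≡0) (⊠ᵛ-0ᵛ c)))) , subst R (pointsOn-⊠ᵛ c a c≢0) r)
      (λ ((a⊥S , a≢0) , r) →
        (⊥-⊠ᵛ c a a⊥S , (λ ca≡0 → a≢0 (⊠ᵛ-cancel-≡0ᵛ c a c≢0 ca≡0))) , subst R (sym (pointsOn-⊠ᵛ c a c≢0)) r)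
      _ _

  spanCount-∷-separated : ∀ {S v} → v ∈ G → Separated S v → spanCount S < spanCount (v ∷ S)
  spanCount-∷-separated {S} {v} v∈G (a₀ , a₀⊥S , a₀v≢0) =
    ∑-mono-< G (λ u → 𝟙-mono (λ inSpan a → inSpan a ∘ All.tail) (InSpan? S u) (InSpan? (v ∷ S) u)) v∈G
      (subst₂ _<_ (sym (𝟙-no (InSpan? S v) (λ inSpan → a₀v≢0 (inSpan a₀ a₀⊥S)))) (sym (𝟙-yes (InSpan? (v ∷ S) v) (λ a → All.head)))
        (s≤s z≤n))

  length≤spanCount : ∀ {S} → S ⊆ G → length S ≤ spanCount S
  length≤spanCount {S} S⊆G = begin
    length S              ≡⟨ sym (count-All (InSpan? S) (All.tabulate (λ u∈S a a⊥S → All.lookup a⊥S u∈S))) ⟩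
    count (InSpan? S) S   ≤⟨ ∑-mono-⊆ _ S⊆G ⟩
    spanCount S           ∎
    where open ≤-Reasoning

  all-inSpan⊎separated : ∀ S → All (InSpan S) G ⊎ ∃ λ v → v ∈ G × Separated S v
  all-inSpan⊎separated S with All.all? (InSpan? S) G
  ... | yes all = inj₁ all
  ... | no ¬all with find (¬All⇒Any¬ (InSpan? S) G ¬all)
  ...   | v , v∈G , ¬inSpan with inSpan⊎separated S v
  ...     | inj₁ inSpan    = ⊥-elim (¬inSpan inSpan)
  ...     | inj₂ separated = inj₂ (v , v∈G , separated)

  module AsMDS (κ s : ℕ) (k≡3+κ : k ≡ 3 + κ) (|G|≡ : length G ≡ (s + 1) * (q + 1) + κ)
               (pointsOn≤ : ∀ a → a ≢ 0ᵛ → pointsOn a ≤ 2 + κ + s) where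

    m : ℕ
    m = 2 + κ + s

    deficiency-identity-for : ∀ S u f → annihilatorSize S ≡ q * (q * u) → spanCount S ≡ suc κ + f →
      q * u * s + q * u * f * (q ∸ 1) + deficiency m S ≡ s * q + (q ∸ 1)
    deficiency-identity-for S u f |S⊥|≡ t≡ =
      deficiency-identity q s κ u f {length G} {spanCount S} {annihilatorSize S}
        (incidences S) (deficiency m S) (nonzeroAnnihilators S) |G|≡ t≡ |S⊥|≡
        (incidences+deficiency pointsOn≤ S) (incidence-equation S) (sym (annihilatorSize≡nonzero+1 S))

    private
      excess : ∀ {t} → suc κ ≤ t → t ≡ suc κ + (t ∸ suc κ)
      excess 1+κ≤t = sym (m+[n∸m]≡n 1+κ≤t)

    spanCount-exact : ∀ S e → annihilatorSize S ≡ q ^ (2 + e) → suc κ ≤ spanCount S → spanCount S ≡ suc κ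
    spanCount-exact S e |S⊥|≡ 1+κ≤t = begin
      spanCount S                        ≡⟨ excess 1+κ≤t ⟩
      suc κ + (spanCount S ∸ suc κ)      ≡⟨ cong (suc κ +_) no-excess ⟩
      suc κ + 0                          ≡⟨ +-identityʳ (suc κ) ⟩
      suc κ                              ∎
      where
      open ≡-Reasoning
      no-excess : spanCount S ∸ suc κ ≡ 0
      no-excess = deficiency-identity⇒f≡0 q s (q ^ e) _ _ 2≤q (m^n>0 q e)
        (deficiency-identity-for S (q ^ e) _ |S⊥|≡ (excess 1+κ≤t))

    |G|≢1+κ : length G ≢ suc κ
    |G|≢1+κ |G|≡1+κ = <⇒≢ (≤-trans (s≤s z≤n) 2≤q) (sym (+-cancelʳ-≡ 1 q 0 q+1≡1))
      where
      q+1≡1 : q + 1 ≡ 1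
      q+1≡1 = m*n≡1⇒n≡1 (s + 1) (q + 1) (+-cancelʳ-≡ κ _ 1 (trans (sym |G|≡) |G|≡1+κ))

    codimension-two : ∀ S e → annihilatorSize S ≡ q ^ (2 + e) → suc κ ≤ spanCount S → e ≡ 0
    codimension-two S zero    _ _ = refl
    codimension-two S (suc e) |S⊥|≡ 1+κ≤t with all-inSpan⊎separated S
    ... | inj₁ all = ⊥-elim (|G|≢1+κ (trans (sym (count-All (InSpan? S) all)) (spanCount-exact S (suc e) |S⊥|≡ 1+κ≤t)))
    ... | inj₂ (v , v∈G , separated@(a₀ , a₀⊥S , a₀v≢0)) = ⊥-elim (<⇒≢ t<t′ (trans t≡1+κ (sym t′≡1+κ)))
      where
      t<t′ : spanCount S < spanCount (v ∷ S)
      t<t′ = spanCount-∷-separated v∈G separated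
      t≡1+κ : spanCount S ≡ suc κ
      t≡1+κ = spanCount-exact S (suc e) |S⊥|≡ 1+κ≤t
      |vS⊥|≡ : annihilatorSize (v ∷ S) ≡ q ^ (2 + e)
      |vS⊥|≡ = *-cancelˡ-≡ _ _ q (trans (annihilatorSize-∷-separated a₀ a₀⊥S a₀v≢0) |S⊥|≡)
      t′≡1+κ : spanCount (v ∷ S) ≡ suc κ
      t′≡1+κ = spanCount-exact (v ∷ S) e |vS⊥|≡ (≤-trans 1+κ≤t (<⇒≤ t<t′))

    module Codimension2 {S} (|S|≡1+κ : length S ≡ suc κ) (1+κ≤t : suc κ ≤ spanCount S) where

      annihilatorSize≡q² : annihilatorSize S ≡ q ^ 2
      annihilatorSize≡q² with annihilatorSize-power S
      ... | e , |S⊥|≡qᵉ , k≤e+|S| = subst (λ e → annihilatorSize S ≡ q ^ e) e≡2 |S⊥|≡qᵉ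
        where
        2≤e : 2 ≤ e
        2≤e = +-cancelʳ-≤ (suc κ) 2 e (subst₂ (λ k l → k ≤ e + l) k≡3+κ |S|≡1+κ k≤e+|S|)
        e≡2+[e∸2] : e ≡ 2 + (e ∸ 2)
        e≡2+[e∸2] = sym (m+[n∸m]≡n 2≤e)
        e≡2 : e ≡ 2
        e≡2 = trans e≡2+[e∸2] (cong (2 +_) (codimension-two S (e ∸ 2) (trans |S⊥|≡qᵉ (cong (q ^_) e≡2+[e∸2])) 1+κ≤t))

      deficiency≡q-1 : deficiency m S ≡ q-1
      deficiency≡q-1 = deficiency-identity⇒X≡q-1 q s (deficiency m S)
        (deficiency-identity-for S 1 0 annihilatorSize≡q²
          (trans (spanCount-exact S 0 annihilatorSize≡q² 1+κ≤t) (sym (+-identityʳ (suc κ)))))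

      private
        nonzero⊥? : ∀ a → Dec (a ⊥ S × a ≢ 0ᵛ)
        nonzero⊥? = nonzeroAnnihilator? S

        shortfall : V k → ℕ
        shortfall a = 𝟙 (nonzero⊥? a) * (m ∸ pointsOn a)

        below? : ∀ a → Dec ((a ⊥ S × a ≢ 0ᵛ) × pointsOn a < m)
        below? a = nonzero⊥? a ×-dec (pointsOn a <? m)

        𝟙below≤shortfall : ∀ a → 𝟙 (below? a) ≤ shortfall a
        𝟙below≤shortfall a with nonzero⊥? a | pointsOn a <? m
        ... | yes _ | yes p<m = subst (1 ≤_) (sym (+-identityʳ _)) (m<n⇒0<n∸m p<m)
        ... | yes _ | no _    = z≤n
        ... | no _  | _       = z≤n

        shortfall≤m*𝟙below : ∀ a → shortfall a ≤ m * 𝟙 (below? a)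
        shortfall≤m*𝟙below a with nonzero⊥? a | pointsOn a <? m
        ... | yes _ | yes _   = subst₂ _≤_ (sym (+-identityʳ _)) (sym (*-identityʳ m)) (m∸n≤m m (pointsOn a))
        ... | yes _ | no p≮m  = subst (_≤ m * 0) (sym (trans (+-identityʳ _) (m≤n⇒m∸n≡0 (≮⇒≥ p≮m)))) z≤n
        ... | no _  | _       = z≤n

      -- The deficiency q - 1 lies between the number L of normals of deficient hyperplanes
      -- through ⟨S⟩ and m L; since q - 1 divides L ≠ 0, L = q - 1 and each deficient
      -- hyperplane misses exactly one point.
      belowCount≡q-1 : hyperplanesThrough (_<? m) S ≡ q-1
      belowCount≡q-1 = ≤-antisym L≤q-1 (∣⇒≤ ⦃ ≢-nonZero L≢0 ⦄ (q-1∣hyperplanesThrough (_<? m) S))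
        where
        L : ℕ
        L = hyperplanesThrough (_<? m) S
        L≤q-1 : L ≤ q-1
        L≤q-1 = subst (L ≤_) deficiency≡q-1 (∑-mono (vectors k) 𝟙below≤shortfall)
        q-1≤m*L : q-1 ≤ m * L
        q-1≤m*L = subst₂ _≤_ deficiency≡q-1 (∑-*ˡ (vectors k) m _) (∑-mono (vectors k) shortfall≤m*𝟙below)
        L≢0 : L ≢ 0
        L≢0 L≡0 = <⇒≱ 1≤q-1 (subst (q-1 ≤_) (trans (cong (m *_) L≡0) (*-zeroʳ m)) q-1≤m*L)

      private
        𝟙below≡shortfall : ∀ a → 𝟙 (below? a) ≡ shortfall a
        𝟙below≡shortfall a = ∑-≤-≡⇒≡ (vectors k) 𝟙below≤shortfall (trans belowCount≡q-1 (sym deficiency≡q-1)) (∈-vectors a)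

      hyperplanesWith-m∸1 : hyperplanesThrough (_≟ℕ m ∸ 1) S ≡ q-1
      hyperplanesWith-m∸1 = trans (∑-cong (vectors k) (λ a → pointwise a (𝟙below≡shortfall a))) belowCount≡q-1
        where
        pointwise : ∀ a → 𝟙 (below? a) ≡ shortfall a → 𝟙 (nonzero⊥? a ×-dec (pointsOn a ≟ℕ m ∸ 1)) ≡ 𝟙 (below? a)
        pointwise a 𝟙≡shortfall with nonzero⊥? a | pointsOn a <? m | pointsOn a ≟ℕ m ∸ 1
        ... | yes _              | yes _   | yes _       = refl
        ... | yes (_ , a≢0)      | yes _   | no p≢m∸1    =
          ⊥-elim (p≢m∸1 (n≤m∧m∸n≡1⇒n≡m∸1 (pointsOn≤ a a≢0) (sym (trans 𝟙≡shortfall (+-identityʳ _)))))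
        ... | yes _              | no p≮m  | yes p≡m∸1   = ⊥-elim (p≮m (≤-reflexive (cong suc p≡m∸1)))
        ... | yes _              | no _    | no _        = refl
        ... | no _               | _       | _           = refl

      hyperplanesWith-m : hyperplanesThrough (_≟ℕ m) S ≡ q * q-1
      hyperplanesWith-m = +-cancelʳ-≡ (q-1 + 1) _ _ (begin
        M + (q-1 + 1)                   ≡⟨ sym (+-assoc M q-1 1) ⟩
        M + q-1 + 1                     ≡⟨ cong (λ x → M + x + 1) (sym belowCount≡q-1) ⟩
        M + hyperplanesThrough (_<? m) S + 1 ≡⟨ cong (_+ 1) (sym (trans (∑-cong (vectors k) split) (∑-+ (vectors k) _ _))) ⟩
        nonzeroAnnihilators S + 1       ≡⟨ sym (annihilatorSize≡nonzero+1 S) ⟩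
        annihilatorSize S               ≡⟨ annihilatorSize≡q² ⟩
        q ^ 2                           ≡⟨ cong (_^ 2) q≡1+q-1 ⟩
        suc q-1 ^ 2                     ≡⟨ square q-1 ⟩
        suc q-1 * q-1 + (q-1 + 1)       ≡⟨ cong (λ x → x * q-1 + (q-1 + 1)) (sym q≡1+q-1) ⟩
        q * q-1 + (q-1 + 1)             ∎)
        where
        open ≡-Reasoning
        M : ℕ
        M = hyperplanesThrough (_≟ℕ m) S
        square : ∀ p → suc p * (suc p * 1) ≡ suc p * p + (p + 1)
        square = solve-∀
        split : ∀ a → 𝟙 (nonzero⊥? a) ≡ 𝟙 (nonzero⊥? a ×-dec (pointsOn a ≟ℕ m)) + 𝟙 (below? a)
        split a with nonzero⊥? a | pointsOn a ≟ℕ m | pointsOn a <? m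
        ... | yes _         | yes p≡m | yes p<m = ⊥-elim (<-irrefl p≡m p<m)
        ... | yes _         | yes _   | no _    = refl
        ... | yes _         | no _    | yes _   = refl
        ... | yes (_ , a≢0) | no p≢m  | no p≮m  = ⊥-elim (p≮m (≤∧≢⇒< (pointsOn≤ a a≢0) p≢m))
        ... | no _          | _       | _       = refl

    module DoubleCounting (j ρ : ℕ) (j+1+ρ≡1+κ : j + suc ρ ≡ suc κ) (j≤|G| : j ≤ length G) where

      private
        front rest : List Point
        front = take j G
        rest = drop j G

        r : ℕ
        r = suc ρ

        |front|≡j : length front ≡ j
        |front|≡j = trans (length-take j G) (m≤n⇒m⊓n≡m j≤|G|)

        flags : ℕ → ℕ
        flags M = ∑ (vectors k) (λ a → 𝟙 (hyperplaneThrough? (_≟ℕ M) front a) * count (a ⊥?_) (combinations r rest))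

        pointsOn-⊥front : ∀ a → a ⊥ front → pointsOn a ≡ j + count (λ v → ⟪ a , v ⟫ ≟ 0#) rest
        pointsOn-⊥front a a⊥front = begin
          pointsOn a
            ≡⟨ pointsOn≡count a ⟩
          count (λ v → ⟪ a , v ⟫ ≟ 0#) G
            ≡⟨ cong (count (λ v → ⟪ a , v ⟫ ≟ 0#)) (sym (take++drop≡id j G)) ⟩
          count (λ v → ⟪ a , v ⟫ ≟ 0#) (front ++ rest)
            ≡⟨ ∑-++ front rest _ ⟩
          count (λ v → ⟪ a , v ⟫ ≟ 0#) front + count (λ v → ⟪ a , v ⟫ ≟ 0#) rest
            ≡⟨ cong (_+ count (λ v → ⟪ a , v ⟫ ≟ 0#) rest) (trans (count-All _ a⊥front) |front|≡j) ⟩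
          j + count (λ v → ⟪ a , v ⟫ ≟ 0#) rest ∎
          where open ≡-Reasoning

        flags-by-normal : ∀ M → flags M ≡ hyperplanesThrough (_≟ℕ M) front * ((M ∸ j) C r)
        flags-by-normal M = trans (∑-cong (vectors k) pointwise) (∑-*ʳ (vectors k) ((M ∸ j) C r) _)
          where
          pointwise : ∀ a → 𝟙 (hyperplaneThrough? (_≟ℕ M) front a) * count (a ⊥?_) (combinations r rest)
                          ≡ 𝟙 (hyperplaneThrough? (_≟ℕ M) front a) * ((M ∸ j) C r)
          pointwise a rewrite count-combinations-All (λ v → ⟪ a , v ⟫ ≟ 0#) r rest with hyperplaneThrough? (_≟ℕ M) front a
          ... | yes ((a⊥front , _) , refl) = cong (λ c → (c C r) + 0) (sym (trans (cong (_∸ j) (pointsOn-⊥front a a⊥front)) (m+n∸m≡n j _)))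
          ... | no _                   = refl

        flags-by-combination : ∀ M → flags M ≡ ∑ (combinations r rest) (λ K → hyperplanesThrough (_≟ℕ M) (front ++ K))
        flags-by-combination M = begin
          flags M
            ≡⟨ ∑-cong (vectors k) (λ a → sym (∑-*ˡ (combinations r rest) (𝟙 (hyperplaneThrough? (_≟ℕ M) front a)) (λ K → 𝟙 (a ⊥? K)))) ⟩
          ∑ (vectors k) (λ a → ∑ (combinations r rest) (λ K → 𝟙 (hyperplaneThrough? (_≟ℕ M) front a) * 𝟙 (a ⊥? K)))
            ≡⟨ ∑-comm (vectors k) (combinations r rest) _ ⟩
          ∑ (combinations r rest) (λ K → ∑ (vectors k) (λ a → 𝟙 (hyperplaneThrough? (_≟ℕ M) front a) * 𝟙 (a ⊥? K)))
            ≡⟨ ∑-cong (combinations r rest) (λ K → ∑-cong (vectors k) (λ a → merge K a)) ⟩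
          ∑ (combinations r rest) (λ K → hyperplanesThrough (_≟ℕ M) (front ++ K)) ∎
          where
          open ≡-Reasoning
          merge : ∀ K a → 𝟙 (hyperplaneThrough? (_≟ℕ M) front a) * 𝟙 (a ⊥? K) ≡ 𝟙 (hyperplaneThrough? (_≟ℕ M) (front ++ K) a)
          merge K a = trans (sym (𝟙-× (hyperplaneThrough? (_≟ℕ M) front a) (a ⊥? K))) (𝟙-cong
            (λ (((a⊥front , a≢0) , p≡M) , a⊥K) → (Allₚ.++⁺ a⊥front a⊥K , a≢0) , p≡M)
            (λ ((a⊥front++K , a≢0) , p≡M) → ((Allₚ.++⁻ˡ front a⊥front++K , a≢0) , p≡M) , Allₚ.++⁻ʳ front a⊥front++K)
            _ (hyperplaneThrough? (_≟ℕ M) (front ++ K) a))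

      double-count : ∀ M val → (∀ {S} → length S ≡ suc κ → suc κ ≤ spanCount S → hyperplanesThrough (_≟ℕ M) S ≡ val) →
        hyperplanesThrough (_≟ℕ M) front * ((M ∸ j) C r) ≡ ((length G ∸ j) C r) * val
      double-count M val constant = begin
        hyperplanesThrough (_≟ℕ M) front * ((M ∸ j) C r)
          ≡⟨ sym (flags-by-normal M) ⟩
        flags M
          ≡⟨ flags-by-combination M ⟩
        ∑ (combinations r rest) (λ K → hyperplanesThrough (_≟ℕ M) (front ++ K))
          ≡⟨ ∑-combinations-const _ val r rest constant-on-front++K ⟩
        (length rest C r) * val
          ≡⟨ cong (λ l → (l C r) * val) (length-drop j G) ⟩
        ((length G ∸ j) C r) * val ∎
        where
        open ≡-Reasoning
        constant-on-front++K : ∀ K → K ⊆ rest → length K ≡ r → hyperplanesThrough (_≟ℕ M) (front ++ K) ≡ val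
        constant-on-front++K K K⊆rest |K|≡r =
          constant |front++K|≡1+κ (subst (_≤ spanCount (front ++ K)) |front++K|≡1+κ (length≤spanCount front++K⊆G))
          where
          |front++K|≡1+κ : length (front ++ K) ≡ suc κ
          |front++K|≡1+κ = trans (length-++ front) (trans (cong₂ _+_ |front|≡j |K|≡r) j+1+ρ≡1+κ)
          front++K⊆G : front ++ K ⊆ G
          front++K⊆G = subst (front ++ K ⊆_) (take++drop≡id j G) (++⁺ ⊆-refl K⊆rest)

      m∸1∸j≡r+s : m ∸ 1 ∸ j ≡ suc ρ + s
      m∸1∸j≡r+s = begin
        suc κ + s ∸ j            ≡⟨ cong (λ x → x + s ∸ j) (sym j+1+ρ≡1+κ) ⟩
        j + suc ρ + s ∸ j        ≡⟨ cong (_∸ j) (+-assoc j (suc ρ) s) ⟩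
        j + (suc ρ + s) ∸ j      ≡⟨ m+n∸m≡n j (suc ρ + s) ⟩
        suc ρ + s                ∎
        where open ≡-Reasoning

      m∸j≡1+r+s : m ∸ j ≡ suc (suc ρ + s)
      m∸j≡1+r+s = begin
        suc (suc κ + s) ∸ j      ≡⟨ cong (λ x → suc (x + s) ∸ j) (sym j+1+ρ≡1+κ) ⟩
        suc (j + suc ρ + s) ∸ j  ≡⟨ cong (λ x → suc x ∸ j) (+-assoc j (suc ρ) s) ⟩
        suc (j + (suc ρ + s)) ∸ j ≡⟨ cong (_∸ j) (sym (+-suc j (suc ρ + s))) ⟩
        j + suc (suc ρ + s) ∸ j  ≡⟨ m+n∸m≡n j (suc (suc ρ + s)) ⟩
        suc (suc ρ + s)          ∎
        where open ≡-Reasoning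

      C[m∸1∸j]∣C[n∸j] : ((m ∸ 1 ∸ j) C suc ρ) ∣ ((length G ∸ j) C suc ρ)
      C[m∸1∸j]∣C[n∸j] = d∣m∧m*c≡n*d⇒c∣n (q-1∣hyperplanesThrough (_≟ℕ m ∸ 1) front)
        (double-count (m ∸ 1) q-1 (λ |S|≡1+κ 1+κ≤t → Codimension2.hyperplanesWith-m∸1 |S|≡1+κ 1+κ≤t))

      C[m∸j]∣C[n∸j]*q : ((m ∸ j) C suc ρ) ∣ ((length G ∸ j) C suc ρ) * q
      C[m∸j]∣C[n∸j]*q = d∣m∧m*c≡n*d⇒c∣n (q-1∣hyperplanesThrough (_≟ℕ m) front)
        (trans (double-count m (q * q-1) (λ |S|≡1+κ 1+κ≤t → Codimension2.hyperplanesWith-m |S|≡1+κ 1+κ≤t))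
               (sym (*-assoc ((length G ∸ j) C suc ρ) q q-1)))

      C[m∸1∸j]*[m∸j]∣C[n∸j]*q[s+1] : ((m ∸ 1 ∸ j) C suc ρ) * (m ∸ j) ∣ ((length G ∸ j) C suc ρ) * (q * (s + 1))
      C[m∸1∸j]*[m∸j]∣C[n∸j]*q[s+1] =
        subst₂ _∣_ absorb (*-assoc ((length G ∸ j) C suc ρ) q (s + 1)) (*-monoˡ-∣ (s + 1) C[m∸j]∣C[n∸j]*q)
        where
        open ≡-Reasoning
        absorb : ((m ∸ j) C suc ρ) * (s + 1) ≡ ((m ∸ 1 ∸ j) C suc ρ) * (m ∸ j)
        absorb = begin
          ((m ∸ j) C suc ρ) * (s + 1)               ≡⟨ cong₂ (λ x y → (x C suc ρ) * y) m∸j≡1+r+s (+-comm s 1) ⟩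
          (suc (suc ρ + s) C suc ρ) * suc s         ≡⟨ sym ([k+s]Ck*[k+s+1]≡[k+s+1]Ck*[s+1] (suc ρ) s) ⟩
          ((suc ρ + s) C suc ρ) * suc (suc ρ + s)   ≡⟨ sym (cong₂ (λ x y → (x C suc ρ) * y) m∸1∸j≡r+s m∸j≡1+r+s) ⟩
          ((m ∸ 1 ∸ j) C suc ρ) * (m ∸ j)           ∎

mainTheorem8 : (F : FiniteField) (k n d s : ℕ) (G : List (Vecᶠ F k))
    → 3 ≤ k
    → IsAsMDS F s n k d G
    → n ≡ (s + 1) * (FiniteField.order F + 1) + k ∸ 3
    → ∀ j → j ≤ k ∸ 3
    → ((k + s ∸ 2 ∸ j) C (k ∸ 2 ∸ j)) ∣ ((n ∸ j) C (k ∸ 2 ∸ j))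
      × (((k + s ∸ 2 ∸ j) C (k ∸ 2 ∸ j)) * (k + s ∸ 1 ∸ j))
          ∣ (((n ∸ j) C (k ∸ 2 ∸ j)) * (FiniteField.order F * (s + 1)))
mainTheorem8 F (suc (suc (suc κ))) _ d s G (s≤s (s≤s (s≤s z≤n)))
             ((refl , _ , _ , m , (pointsOn≤m , _) , |G|≡m+d) , |G|+1≡k+d+s) |G|≡ j j≤κ
  with m≤n⇒∃[o]m+o≡n j≤κ
... | ρ , refl rewrite [1+m+n]∸m≡1+n j ρ = C[m∸1∸j]∣C[n∸j] , C[m∸1∸j]*[m∸j]∣C[n∸j]*q[s+1]
  where
  open FiniteFieldSums F using (q; 0ᵛ; ≢0ᵛ⇒NonZero)
  open ProjectiveSystemCounting F G
  |G|≡[s+1][q+1]+κ : length G ≡ (s + 1) * (q + 1) + (j + ρ)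
  |G|≡[s+1][q+1]+κ = trans |G|≡ (+-∸-assoc ((s + 1) * (q + 1)) (s≤s (s≤s (s≤s z≤n))))
  pointsOn≤ : ∀ a → a ≢ 0ᵛ → pointsOn a ≤ 2 + (j + ρ) + s
  pointsOn≤ a a≢0 =
    subst (pointsOn a ≤_) (singleton-defect⇒m≡2+κ+s (j + ρ) |G|≡m+d |G|+1≡k+d+s) (pointsOn≤m (lookup a) (≢0ᵛ⇒NonZero a a≢0))
  j≤|G| : j ≤ length G
  j≤|G| = subst (j ≤_) (sym |G|≡[s+1][q+1]+κ) (≤-trans (m≤m+n j ρ) (m≤n+m (j + ρ) ((s + 1) * (q + 1))))
  open AsMDS (j + ρ) s refl |G|≡[s+1][q+1]+κ pointsOn≤
  open DoubleCounting j ρ (+-suc j ρ) j≤|G|
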